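{- Let $q>0$, $k\le n$, $\sigma\in\mathfrak{S}_k$, and $\pi\sim\mathrm{Maj}(n,q)$. For any fixed indices $i_1<i_2<\dots<i_k$ in $[n]$, the probability that $(\pi^{ -1}(i_1),\dots,\pi^{ -1}(i_k))$ is order-isomorphic to $\sigma^{ -1}$ (i.e. these indices form the pattern $\sigma^{ -1}$ in $\pi^{ -1}$) equals \[ \frac{q^{\mathrm{maj}(\sigma)}}{[k]_q!}. \]
   Context: $\mathrm{Maj}(n,q)$ is the distribution on $\mathfrak{S}_n$ with $\mathbb{P}(\mathrm{Maj}(n,q)=\pi)=q^{\mathrm{maj}(\pi)}/[n]_q!$, where $\mathrm{maj}(\pi)=\sum_{i:\pi(i)>\pi(i+1)} i$, $[m]_q=1+q+\dots+q^{m-1}$, $[n]_q!=\prod_{m=1}^n[m]_q$. -}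

module Defs where

open import Level using (Level)
open import Data.Bool using (Bool; true; false; if_then_else_; _∧_)
open import Data.Nat using (ℕ; zero; suc; _<ᵇ_) renaming (_+_ to _+ℕ_)
open import Data.Fin using (Fin; toℕ; _<_) renaming (zero to fzero; suc to fsuc)
open import Data.Fin.Properties using (_≟_)
open import Data.Vec using (Vec; []; _∷_; lookup)
open import Data.List using (List; []; _∷_; map; concatMap; allFin; filterᵇ; foldr)
open import Data.Bool.ListAction using (and)
open import Relation.Nullary.Decidable using (⌊_⌋)
open import Algebra.Bundles using (CommutativeSemiring)

_==ᵇ_ : Bool → Bool → Bool
true  ==ᵇ b = b
false ==ᵇ true = false
false ==ᵇ false = true

allVecs : (n m : ℕ) → List (Vec (Fin m) n)
allVecs zero    m = [] ∷ []
allVecs (suc n) m = concatMap (λ x → map (x ∷_) (allVecs n m)) (allFin m)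

posOf : ∀ {n m} → Vec (Fin m) n → Fin m → ℕ
posOf []       j = 0
posOf (x ∷ xs) j = if ⌊ x ≟ j ⌋ then 0 else suc (posOf xs j)

-- w : Vec (Fin n) n is a permutation of [n] (one-line notation) iff it is injective
isPerm : ∀ {n} → Vec (Fin n) n → Bool
isPerm {n} w = and (concatMap (λ i → map (λ j →
  if ⌊ i ≟ j ⌋ then true else (if ⌊ lookup w i ≟ lookup w j ⌋ then false else true))
  (allFin n)) (allFin n))

perms : (n : ℕ) → List (Vec (Fin n) n)
perms n = filterᵇ isPerm (allVecs n n)

inv : ∀ {n} → Vec (Fin n) n → Fin n → ℕ
inv w j = posOf w j

-- major index: maj(π) = Σ_{i : π(i) > π(i+1)} i   (positions 1-based)
majFrom : ∀ {m n} → ℕ → Vec (Fin m) n → ℕ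
majFrom i []            = 0
majFrom i (x ∷ [])      = 0
majFrom i (x ∷ y ∷ xs)  =
  (if toℕ y <ᵇ toℕ x then i else 0) +ℕ majFrom (suc i) (y ∷ xs)

maj : ∀ {m n} → Vec (Fin m) n → ℕ
maj w = majFrom 1 w

-- pattern condition: (π⁻¹(ι 1), …, π⁻¹(ι k)) is order-isomorphic to σ⁻¹
occursAt : ∀ {n k} → Vec (Fin n) n → (Fin k → Fin n) → Vec (Fin k) k → Bool
occursAt {n} {k} π ι σ = and (concatMap (λ a → map (λ b →
  (inv π (ι a) <ᵇ inv π (ι b)) ==ᵇ (inv σ a <ᵇ inv σ b))
  (allFin k)) (allFin k))

module _ {c ℓ : Level} (R : CommutativeSemiring c ℓ) where
  open CommutativeSemiring R

  pow : Carrier → ℕ → Carrier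
  pow x zero    = 1#
  pow x (suc n) = x * pow x n

  qint : Carrier → ℕ → Carrier
  qint q zero    = 0#
  qint q (suc m) = pow q m + qint q m

  qfact : Carrier → ℕ → Carrier
  qfact q zero    = 1#
  qfact q (suc n) = qint q (suc n) * qfact q n

  majSum : ∀ {n} → Carrier → List (Vec (Fin n) n) → Carrier
  majSum q L = foldr (λ π acc → pow q (maj π) + acc) 0# L

{-# OPTIONS --safe #-}
module Submission where

open import Defs
open import Level using (Level)
open import Data.Bool using (Bool; true; false; if_then_else_; _∧_; T)
open import Data.Bool.ListAction using (and)
open import Data.Bool.Properties using (∨-comm; T-≡)
open import Data.Nat as ℕ using (ℕ; zero; suc; _≤_; _<ᵇ_; z≤n; s≤s)
import Data.Nat.Properties as ℕₚ
open import Data.Fin as Fin using (Fin; _<_; toℕ; fromℕ; fromℕ<; inject₁)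
import Data.Fin.Properties as Finₚ
import Data.Fin.Permutation.Components as Components
open import Data.Fin.Induction using (>-weakInduction)
open import Data.Vec as Vec using (Vec; []; _∷_; lookup)
import Data.Vec.Properties as Vecₚ
import Data.Vec.Relation.Unary.Any as VAny
import Data.Vec.Relation.Unary.Any.Properties as VAnyₚ
import Data.Vec.Membership.Propositional.Properties as VMemₚ
import Data.List.Properties as Listₚ
open import Data.List as List using (List; []; _∷_; _∷ʳ_; map; concatMap; allFin; filterᵇ)
open import Data.List.Reverse using (Reverse; reverseView; []; _∶_∶ʳ_)
open import Data.List.Relation.Unary.All as All using (All; []; _∷_)
open import Data.List.Relation.Unary.AllPairs using ([]; _∷_)
open import Data.List.Relation.Unary.Any using (here; there)
open import Data.List.Relation.Unary.Unique.Propositional using (Unique)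
import Data.List.Relation.Unary.Unique.Propositional.Properties as Uniqueₚ
open import Data.List.Membership.Propositional using (_∈_)
open import Data.List.Membership.Propositional.Properties
  using (∈-allFin; ∈-cartesianProductWith⁺; ∈-cartesianProduct⁺)
import Data.List.Relation.Unary.All.Properties as Allₚ
open import Data.Product as Product using (∃; _×_; _,_; proj₁; proj₂; uncurry)
open import Data.Unit using (tt)
open import Data.Sum as Sum using (_⊎_; inj₁; inj₂)
open import Function using (_∘_; id; _⇔_; mk⇔; Equivalence)
open import Function.Definitions using (Injective)
open import Relation.Nullary using (¬_; Dec; does; yes; no; contradiction)
open import Relation.Nullary.Decidable using (⌊_⌋; _⊎-dec_; dec-true; dec-false)
open import Relation.Binary.Definitions using (DecidableEquality)
open import Relation.Nullary.Reflects using (det; fromEquivalence)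
open import Relation.Binary.PropositionalEquality
  using (_≡_; _≢_; refl; sym; trans; cong; cong₂; subst; subst₂; module ≡-Reasoning)
open import Algebra.Bundles using (CommutativeSemiring)

open Equivalence using (to; from)

-- Write F(n, ι) for the sum of q^maj(π) over those π ∈ S_n in which the values ι(0) < … < ι(k-1)
-- appear in the relative order prescribed by σ. If k = n then ι is the identity and only π = σ
-- contributes. Otherwise ι misses some value c < n. Exchanging the values c and c+1 in π, unless they
-- occupy adjacent positions, is a maj-preserving involution of S_n that turns occurrences at ι into
-- occurrences at τ ∘ ι, where τ transposes c and c+1; as τ ∘ ι misses c+1, the missed value can be
-- pushed up to n-1. Then every π arises exactly once by inserting n-1 into one of the n gaps of a
-- permutation of [n-1], and by MacMahon's argument these gaps raise maj by 0, 1, …, n-1 in some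
-- order; so F(n, ι) = [n]_q F(n-1, ι), and induction on n gives F(n, ι) [k]_q! = q^maj(σ) [n]_q!.

and≡true⁺ : ∀ {bs} → All (_≡ true) bs → and bs ≡ true
and≡true⁺ []          = refl
and≡true⁺ (refl ∷ ps) = and≡true⁺ ps

and≡true⁻ : ∀ bs → and bs ≡ true → All (_≡ true) bs
and≡true⁻ []           _ = []
and≡true⁻ (true ∷ bs)  e = refl ∷ and≡true⁻ bs e
and≡true⁻ (false ∷ bs) ()

and-allFin²≡true⇔ : ∀ {k} (g : Fin k → Fin k → Bool) →
  and (concatMap (λ a → map (g a) (allFin k)) (allFin k)) ≡ true ⇔ (∀ a b → g a b ≡ true)
and-allFin²≡true⇔ g = mk⇔
  (λ e a b → Allₚ.tabulate⁻ (Allₚ.map⁻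
    (Allₚ.tabulate⁻ (Allₚ.map⁻ (Allₚ.concat⁻ (and≡true⁻ _ e))) a)) b)
  (λ g≡true → and≡true⁺ (Allₚ.concat⁺ (Allₚ.map⁺
    (Allₚ.tabulate⁺ λ a → Allₚ.map⁺ (Allₚ.tabulate⁺ (g≡true a))))))

==ᵇ≡true⇔ : ∀ {a b} → (a ==ᵇ b) ≡ true ⇔ a ≡ b
==ᵇ≡true⇔ {true}  {true}  = mk⇔ (λ _ → refl) (λ _ → refl)
==ᵇ≡true⇔ {true}  {false} = mk⇔ (λ ()) (λ ())
==ᵇ≡true⇔ {false} {true}  = mk⇔ (λ ()) (λ ())
==ᵇ≡true⇔ {false} {false} = mk⇔ (λ _ → refl) (λ _ → refl)

∧≡true⇔ : ∀ {a b} → (a ∧ b) ≡ true ⇔ (a ≡ true × b ≡ true)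
∧≡true⇔ {true}  = mk⇔ (refl ,_) proj₂
∧≡true⇔ {false} = mk⇔ (λ ()) (λ { (() , _) })

≡true⇔⇒≡ : ∀ {a b} → (a ≡ true ⇔ b ≡ true) → a ≡ b
≡true⇔⇒≡ {true}  {true}  _ = refl
≡true⇔⇒≡ {true}  {false} a⇔b = sym (to a⇔b refl)
≡true⇔⇒≡ {false} {true}  a⇔b = from a⇔b refl
≡true⇔⇒≡ {false} {false} _ = refl

does≡true⇒ : ∀ {A : Set} (a? : Dec A) → does a? ≡ true → A
does≡true⇒ (yes a) _ = a

<ᵇ-true : ∀ {a b} → a ℕ.< b → (a <ᵇ b) ≡ true
<ᵇ-true a<b = to T-≡ (ℕₚ.<⇒<ᵇ a<b)

<ᵇ-false : ∀ {a b} → ¬ a ℕ.< b → (a <ᵇ b) ≡ false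
<ᵇ-false {a} {b} a≮b with a <ᵇ b in e
... | false = refl
... | true  = contradiction (ℕₚ.<ᵇ⇒< a b (subst T (sym e) tt)) a≮b

<ᵇ-cong : ∀ {a b c d} → (a ℕ.< b ⇔ c ℕ.< d) → (a <ᵇ b) ≡ (c <ᵇ d)
<ᵇ-cong a<b⇔c<d = det (ℕₚ.<ᵇ-reflects-< _ _)
  (fromEquivalence (from a<b⇔c<d ∘ ℕₚ.<ᵇ⇒< _ _) (ℕₚ.<⇒<ᵇ ∘ to a<b⇔c<d))

<ᵇ≡⇒< : ∀ {a b c d} → (a <ᵇ b) ≡ (c <ᵇ d) → c ℕ.< d → a ℕ.< b
<ᵇ≡⇒< {a} {b} ab≡cd c<d = ℕₚ.<ᵇ⇒< a b (subst T (sym ab≡cd) (ℕₚ.<⇒<ᵇ c<d))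

Distinct : ∀ {A : Set} {l} → Vec A l → Set
Distinct w = Injective _≡_ _≡_ (lookup w)

isPerm≡true⇔ : ∀ {n} (w : Vec (Fin n) n) → isPerm w ≡ true ⇔ Distinct w
isPerm≡true⇔ w = mk⇔
  (λ e {i} {j} → to (entry i j) (to (and-allFin²≡true⇔ _) e i j))
  (λ inj → from (and-allFin²≡true⇔ _) (λ i j → from (entry i j) inj))
  where
  entry : ∀ i j → (if ⌊ i Finₚ.≟ j ⌋ then true
                   else (if ⌊ lookup w i Finₚ.≟ lookup w j ⌋ then false else true)) ≡ true
                  ⇔ (lookup w i ≡ lookup w j → i ≡ j)
  entry i j with i Finₚ.≟ j | lookup w i Finₚ.≟ lookup w j
  ... | yes i≡j | _        = mk⇔ (λ _ _ → i≡j) (λ _ → refl)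
  ... | no i≢j  | yes wᵢ≡wⱼ = mk⇔ (λ ()) (λ inj → contradiction (inj wᵢ≡wⱼ) i≢j)
  ... | no _    | no wᵢ≢wⱼ  = mk⇔ (λ _ wᵢ≡wⱼ → contradiction wᵢ≡wⱼ wᵢ≢wⱼ) (λ _ → refl)

before : ∀ {n k} → Vec (Fin n) n → (Fin k → Fin n) → Fin k → Fin k → Bool
before π ι a b = inv π (ι a) <ᵇ inv π (ι b)

occursAt≡true⇔ : ∀ {n k} (π : Vec (Fin n) n) ι (σ : Vec (Fin k) k) →
  occursAt π ι σ ≡ true ⇔ (∀ a b → before π ι a b ≡ before σ id a b)
occursAt≡true⇔ π ι σ = mk⇔
  (λ e a b → to ==ᵇ≡true⇔ (to (and-allFin²≡true⇔ _) e a b))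
  (λ agree → from (and-allFin²≡true⇔ _) (λ a b → from ==ᵇ≡true⇔ (agree a b)))

occursAt-cong : ∀ {n n′ k} (π : Vec (Fin n) n) ι (π′ : Vec (Fin n′) n′) ι′ (σ : Vec (Fin k) k) →
  (∀ a b → before π ι a b ≡ before π′ ι′ a b) → occursAt π ι σ ≡ occursAt π′ ι′ σ
occursAt-cong π ι π′ ι′ σ agree = ≡true⇔⇒≡ (mk⇔
  (λ e → from (occursAt≡true⇔ π′ ι′ σ) λ a b → trans (sym (agree a b)) (to (occursAt≡true⇔ π ι σ) e a b))
  (λ e → from (occursAt≡true⇔ π ι σ) λ a b → trans (agree a b) (to (occursAt≡true⇔ π′ ι′ σ) e a b)))

before-cong : ∀ {n k} (π : Vec (Fin n) n) {ι ι′ : Fin k → Fin n} → (∀ a → ι a ≡ ι′ a) →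
  ∀ a b → before π ι a b ≡ before π ι′ a b
before-cong π ι≗ι′ a b = cong₂ (λ x y → inv π x <ᵇ inv π y) (ι≗ι′ a) (ι≗ι′ b)

isOccurrence : ∀ {n k} → Vec (Fin k) k → (Fin k → Fin n) → Vec (Fin n) n → Bool
isOccurrence σ ι w = isPerm w ∧ occursAt w ι σ

isOccurrence≡true⇔ : ∀ {n k} (σ : Vec (Fin k) k) ι (w : Vec (Fin n) n) →
  isOccurrence σ ι w ≡ true ⇔ (Distinct w × occursAt w ι σ ≡ true)
isOccurrence≡true⇔ σ ι w = mk⇔ split join
  where
  split : isOccurrence σ ι w ≡ true → Distinct w × occursAt w ι σ ≡ true
  split e = to (isPerm≡true⇔ w) (proj₁ (to ∧≡true⇔ e)) , proj₂ (to ∧≡true⇔ e)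
  join : Distinct w × occursAt w ι σ ≡ true → isOccurrence σ ι w ≡ true
  join (w-inj , w-occ) = from ∧≡true⇔ (from (isPerm≡true⇔ w) w-inj , w-occ)

lookup-posOf : ∀ {m l} (w : Vec (Fin m) l) x (lt : posOf w x ℕ.< l) → lookup w (fromℕ< lt) ≡ x
lookup-posOf (y ∷ w) x lt with y Finₚ.≟ x
... | yes y≡x = y≡x
... | no _    = lookup-posOf w x (ℕₚ.≤-pred lt)

posOf-lookup : ∀ {m l} (w : Vec (Fin m) l) → Distinct w → ∀ p → posOf w (lookup w p) ≡ toℕ p
posOf-lookup (y ∷ w) inj Fin.zero with y Finₚ.≟ y
... | yes _  = refl
... | no y≢y = contradiction refl y≢y
posOf-lookup (y ∷ w) inj (Fin.suc p) with y Finₚ.≟ lookup w p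
... | yes y≡wₚ = contradiction (inj {Fin.zero} {Fin.suc p} y≡wₚ) λ ()
... | no _     = cong suc (posOf-lookup w (Finₚ.suc-injective ∘ inj) p)

posOf-map : ∀ {m m′ l} {f : Fin m → Fin m′} → Injective _≡_ _≡_ f →
  ∀ (w : Vec (Fin m) l) x → posOf (Vec.map f w) (f x) ≡ posOf w x
posOf-map f-inj []      x = refl
posOf-map {f = f} f-inj (y ∷ w) x with y Finₚ.≟ x | f y Finₚ.≟ f x
... | yes _   | yes _     = refl
... | no _    | no _      = cong suc (posOf-map f-inj w x)
... | yes y≡x | no fy≢fx  = contradiction (cong f y≡x) fy≢fx
... | no y≢x  | yes fy≡fx = contradiction (f-inj fy≡fx) y≢x

injective⇒onto : ∀ {n} {f : Fin n → Fin n} → Injective _≡_ _≡_ f → ∀ y → ∃ λ x → f x ≡ y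
injective⇒onto {suc n} {f} f-inj y with Finₚ.any? (λ x → f x Finₚ.≟ y)
... | yes hit = hit
... | no miss = contradiction (Finₚ.injective⇒≤ g-inj) (ℕₚ.<-irrefl refl)
  where
  g : Fin (suc n) → Fin n
  g x = Fin.punchOut {i = y} {j = f x} (λ y≡fx → miss (x , sym y≡fx))
  g-inj : Injective _≡_ _≡_ g
  g-inj {x} {x′} gx≡gx′ = f-inj (Finₚ.punchOut-injective {i = y} _ _ gx≡gx′)

<⇒misses-value : ∀ {k n} → k ℕ.< n → (f : Fin k → Fin n) → ∃ λ y → ∀ x → f x ≢ y
<⇒misses-value {n = n} k<n f
  with Finₚ.¬∀⟶∃¬ n (λ y → ∃ λ x → f x ≡ y) (λ y → Finₚ.any? (λ x → f x Finₚ.≟ y)) onto⇒n≤k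
  where
  onto⇒n≤k : ¬ (∀ y → ∃ λ x → f x ≡ y)
  onto⇒n≤k onto = ℕₚ.<⇒≱ k<n (Finₚ.injective⇒≤ {f = proj₁ ∘ onto}
    (λ {y} {y′} e → trans (sym (proj₂ (onto y))) (trans (cong f e) (proj₂ (onto y′)))))
... | y , missed = y , λ x fx≡y → missed (x , fx≡y)

posOf<n : ∀ {n} (w : Vec (Fin n) n) → Distinct w → ∀ x → posOf w x ℕ.< n
posOf<n w inj x with injective⇒onto inj x
... | p , refl = subst (ℕ._< _) (sym (posOf-lookup w inj p)) (Finₚ.toℕ<n p)

posOf-injective : ∀ {n} (w : Vec (Fin n) n) → Distinct w → Injective _≡_ _≡_ (posOf w)
posOf-injective w inj {x} {y} pₓ≡pᵧ with injective⇒onto inj x | injective⇒onto inj y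
... | p , refl | p′ , refl =
  cong (lookup w) (Finₚ.toℕ-injective
    (trans (sym (posOf-lookup w inj p)) (trans pₓ≡pᵧ (posOf-lookup w inj p′))))

Increasing : ∀ {k n} → (Fin k → Fin n) → Set
Increasing ι = ∀ a b → a < b → ι a < ι b

increasing-≥ : ∀ {k n} {ι : Fin k → Fin n} → Increasing ι → ∀ a → toℕ a ≤ toℕ (ι a)
increasing-≥ inc Fin.zero = z≤n
increasing-≥ {suc k} {ι = ι} inc (Fin.suc a) =
  ℕₚ.≤-<-trans (increasing-≥ inc∘inject₁ a)
    (inc (inject₁ a) (Fin.suc a) (Finₚ.≤̄⇒inject₁< ℕₚ.≤-refl))
  where
  inc∘inject₁ : Increasing (ι ∘ inject₁)
  inc∘inject₁ a b a<b = inc (inject₁ a) (inject₁ b)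
    (subst₂ ℕ._<_ (sym (Finₚ.toℕ-inject₁ a)) (sym (Finₚ.toℕ-inject₁ b)) a<b)

opposite-reverses-< : ∀ {n} {i j : Fin n} → i < j → Fin.opposite j < Fin.opposite i
opposite-reverses-< {i = i} {j} i<j rewrite Finₚ.opposite-prop i | Finₚ.opposite-prop j =
  ℕₚ.∸-monoʳ-< (s≤s i<j) (Finₚ.toℕ<n j)

increasing⇒≡id : ∀ {n} {ι : Fin n → Fin n} → Increasing ι → ∀ a → ι a ≡ a
increasing⇒≡id {n} {ι} inc a = Finₚ.toℕ-injective (ℕₚ.≤-antisym ι[a]≤a (increasing-≥ inc a))
  where
  -- the lower bound for the reflected map is the upper bound for ι
  reflected : Fin n → Fin n
  reflected = Fin.opposite ∘ ι ∘ Fin.opposite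
  reflected-inc : Increasing reflected
  reflected-inc a b = opposite-reverses-< ∘ inc _ _ ∘ opposite-reverses-<
  n∸a≤n∸ι[a] : n ℕ.∸ suc (toℕ a) ≤ n ℕ.∸ suc (toℕ (ι a))
  n∸a≤n∸ι[a] = subst₂ _≤_ (Finₚ.opposite-prop a)
    (trans (cong (toℕ ∘ Fin.opposite ∘ ι) (Finₚ.opposite-involutive a)) (Finₚ.opposite-prop (ι a)))
    (increasing-≥ reflected-inc (Fin.opposite a))
  ι[a]≤a : toℕ (ι a) ≤ toℕ a
  ι[a]≤a = ℕₚ.≤-pred (ℕₚ.∸-cancelʳ-≤ (Finₚ.toℕ<n (ι a)) n∸a≤n∸ι[a])

order-of-positions-determines-word : ∀ {n} (w σ : Vec (Fin n) n) → Distinct w → Distinct σ →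
  (∀ x y → before w id x y ≡ before σ id x y) → w ≡ σ
order-of-positions-determines-word {n} w σ w-inj σ-inj agree =
  trans (sym (Vecₚ.tabulate∘lookup w)) (trans (Vecₚ.tabulate-cong wₚ≡σₚ) (Vecₚ.tabulate∘lookup σ))
  where
  positionInσ : Fin n → Fin n
  positionInσ p = fromℕ< (posOf<n σ σ-inj (lookup w p))
  positionInσ-inc : Increasing positionInσ
  positionInσ-inc p p′ p<p′ = subst₂ ℕ._<_
    (sym (Finₚ.toℕ-fromℕ< _)) (sym (Finₚ.toℕ-fromℕ< _))
    (<ᵇ≡⇒< (sym (agree (lookup w p) (lookup w p′)))
      (subst₂ ℕ._<_ (sym (posOf-lookup w w-inj p)) (sym (posOf-lookup w w-inj p′)) p<p′))
  wₚ≡σₚ : ∀ p → lookup w p ≡ lookup σ p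
  wₚ≡σₚ p = trans (sym (lookup-posOf σ (lookup w p) (posOf<n σ σ-inj (lookup w p))))
    (cong (lookup σ) (increasing⇒≡id positionInσ-inc p))

concatMap-map≡cartesianProductWith : ∀ {A B C : Set} (f : A → B → C) xs ys →
  concatMap (λ x → map (f x) ys) xs ≡ List.cartesianProductWith f xs ys
concatMap-map≡cartesianProductWith f []       ys = refl
concatMap-map≡cartesianProductWith f (x ∷ xs) ys =
  cong (map (f x) ys List.++_) (concatMap-map≡cartesianProductWith f xs ys)

∈-allVecs : ∀ n m (v : Vec (Fin m) n) → v ∈ allVecs n m
∈-allVecs zero    m []      = here refl
∈-allVecs (suc n) m (x ∷ v) = subst (x ∷ v ∈_)
  (sym (concatMap-map≡cartesianProductWith _∷_ (allFin m) (allVecs n m)))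
  (∈-cartesianProductWith⁺ _∷_ (∈-allFin x) (∈-allVecs n m v))

allVecs-unique : ∀ n m → Unique (allVecs n m)
allVecs-unique zero    m = [] ∷ []
allVecs-unique (suc n) m = subst Unique
  (sym (concatMap-map≡cartesianProductWith _∷_ (allFin m) (allVecs n m)))
  (Uniqueₚ.cartesianProductWith⁺ _∷_ Vecₚ.∷-injective (Uniqueₚ.allFin⁺ m) (allVecs-unique n m))

tabulate∘toℕ : ∀ {A : Set} n (h : ℕ → A) → List.tabulate {n = n} (h ∘ toℕ) ≡ List.applyUpTo h n
tabulate∘toℕ zero    h = refl
tabulate∘toℕ (suc n) h = cong (h 0 ∷_) (tabulate∘toℕ n (h ∘ suc))

map-toℕ-allFin : ∀ n → map toℕ (allFin n) ≡ List.upTo n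
map-toℕ-allFin n = trans (Listₚ.map-tabulate id toℕ) (tabulate∘toℕ n id)

module Sums {c ℓ : Level} (R : CommutativeSemiring c ℓ) where
  open CommutativeSemiring R hiding (zero) renaming (refl to ≈-refl; sym to ≈-sym; trans to ≈-trans)
  open import Relation.Binary.Reasoning.Setoid setoid
  open import Algebra.Properties.CommutativeSemigroup +-commutativeSemigroup using (interchange)

  ∑ : ∀ {A : Set} → List A → (A → Carrier) → Carrier
  ∑ xs f = List.foldr (λ x acc → f x + acc) 0# xs

  syntax ∑ xs (λ x → e) = ∑[ x ∈ xs ] e

  ∑-cong-All : ∀ {A : Set} {xs : List A} {f g : A → Carrier} →
    All (λ x → f x ≈ g x) xs → ∑ xs f ≈ ∑ xs g
  ∑-cong-All []             = ≈-refl
  ∑-cong-All (fx≈gx ∷ f≈g) = +-cong fx≈gx (∑-cong-All f≈g)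

  ∑-cong : ∀ {A : Set} (xs : List A) {f g : A → Carrier} → (∀ x → f x ≈ g x) → ∑ xs f ≈ ∑ xs g
  ∑-cong xs f≈g = ∑-cong-All (All.universal f≈g xs)

  ∑-zero : ∀ {A : Set} {xs : List A} {f : A → Carrier} → All (λ x → f x ≈ 0#) xs → ∑ xs f ≈ 0#
  ∑-zero []           = ≈-refl
  ∑-zero (fx≈0 ∷ f≈0) = ≈-trans (+-cong fx≈0 (∑-zero f≈0)) (+-identityˡ 0#)

  ∑-filterᵇ : ∀ {A : Set} (p : A → Bool) (xs : List A) (f : A → Carrier) →
    ∑ (filterᵇ p xs) f ≈ ∑[ x ∈ xs ] (if p x then f x else 0#)
  ∑-filterᵇ p []       f = ≈-refl
  ∑-filterᵇ p (x ∷ xs) f with p x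
  ... | true  = +-congˡ (∑-filterᵇ p xs f)
  ... | false = ≈-trans (∑-filterᵇ p xs f) (≈-sym (+-identityˡ _))

  ∑-++ : ∀ {A : Set} (xs ys : List A) (f : A → Carrier) → ∑ (xs List.++ ys) f ≈ ∑ xs f + ∑ ys f
  ∑-++ []       ys f = ≈-sym (+-identityˡ _)
  ∑-++ (x ∷ xs) ys f = ≈-trans (+-congˡ (∑-++ xs ys f)) (≈-sym (+-assoc _ _ _))

  ∑-map : ∀ {A B : Set} (g : A → B) (xs : List A) (f : B → Carrier) → ∑ (map g xs) f ≡ ∑ xs (f ∘ g)
  ∑-map g []       f = refl
  ∑-map g (x ∷ xs) f = cong (f (g x) +_) (∑-map g xs f)

  ∑-cartesianProductWith : ∀ {A B C : Set} (g : A → B → C) (xs : List A) (ys : List B) (f : C → Carrier) →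
    ∑ (List.cartesianProductWith g xs ys) f ≈ ∑[ x ∈ xs ] ∑[ y ∈ ys ] f (g x y)
  ∑-cartesianProductWith g []       ys f = ≈-refl
  ∑-cartesianProductWith g (x ∷ xs) ys f = begin
    ∑ (map (g x) ys List.++ List.cartesianProductWith g xs ys) f
      ≈⟨ ∑-++ (map (g x) ys) _ f ⟩
    ∑ (map (g x) ys) f + ∑ (List.cartesianProductWith g xs ys) f
      ≈⟨ +-cong (reflexive (∑-map (g x) ys f)) (∑-cartesianProductWith g xs ys f) ⟩
    ∑[ y ∈ ys ] f (g x y) + ∑[ x ∈ xs ] ∑[ y ∈ ys ] f (g x y) ∎

  ∑-+ : ∀ {A : Set} (xs : List A) (f g : A → Carrier) → ∑[ x ∈ xs ] (f x + g x) ≈ ∑ xs f + ∑ xs g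
  ∑-+ []       f g = ≈-sym (+-identityˡ 0#)
  ∑-+ (x ∷ xs) f g = ≈-trans (+-congˡ (∑-+ xs f g)) (interchange _ _ _ _)

  *-distribˡ-∑ : ∀ {A : Set} (k : Carrier) (xs : List A) (f : A → Carrier) →
    k * ∑ xs f ≈ ∑[ x ∈ xs ] (k * f x)
  *-distribˡ-∑ k []       f = zeroʳ k
  *-distribˡ-∑ k (x ∷ xs) f = ≈-trans (distribˡ k _ _) (+-congˡ (*-distribˡ-∑ k xs f))

  ∑-comm : ∀ {A B : Set} (xs : List A) (ys : List B) (f : A → B → Carrier) →
    ∑[ x ∈ xs ] ∑[ y ∈ ys ] f x y ≈ ∑[ y ∈ ys ] ∑[ x ∈ xs ] f x y
  ∑-comm []       ys f = ≈-sym (∑-zero (All.universal (λ _ → ≈-refl) ys))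
  ∑-comm (x ∷ xs) ys f = ≈-trans (+-congˡ (∑-comm xs ys f)) (≈-sym (∑-+ ys (f x) _))

  ∑-single : ∀ {A : Set} {xs : List A} {y} (f : A → Carrier) → Unique xs → y ∈ xs →
    (∀ x → x ≢ y → f x ≈ 0#) → ∑ xs f ≈ f y
  ∑-single f (x≢xs ∷ _) (here refl) vanish =
    ≈-trans (+-congˡ (∑-zero (All.map (λ x≢z → vanish _ (x≢z ∘ sym)) x≢xs))) (+-identityʳ _)
  ∑-single f (x≢xs ∷ xs!) (there y∈xs) vanish =
    ≈-trans (+-cong (vanish _ (All.lookup x≢xs y∈xs)) (∑-single f xs! y∈xs vanish)) (+-identityˡ _)

  ∑-upTo-suc : ∀ n (f : ℕ → Carrier) → ∑ (List.upTo (suc n)) f ≈ ∑ (List.upTo n) f + f n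
  ∑-upTo-suc n f = begin
    ∑ (List.upTo (suc n)) f              ≡⟨ cong (λ xs → ∑ xs f) (sym (Listₚ.upTo-∷ʳ n)) ⟩
    ∑ (List.upTo n List.++ n ∷ []) f     ≈⟨ ∑-++ (List.upTo n) (n ∷ []) f ⟩
    ∑ (List.upTo n) f + (f n + 0#)       ≈⟨ +-congˡ (+-identityʳ (f n)) ⟩
    ∑ (List.upTo n) f + f n              ∎

  ∑-allFin : ∀ n (f : ℕ → Carrier) → ∑[ g ∈ allFin n ] f (toℕ g) ≡ ∑ (List.upTo n) f
  ∑-allFin n f = trans (sym (∑-map toℕ (allFin n) f)) (cong (λ xs → ∑ xs f) (map-toℕ-allFin n))

  module _ {A B : Set} (_≟_ : DecidableEquality A)
    {as : List A} (as! : Unique as) (∈as : ∀ a → a ∈ as)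
    {bs : List B} (bs! : Unique bs) (∈bs : ∀ b → b ∈ bs)
    {P : A → Bool} {Q : B → Bool} (h : B → A) (h⁻¹ : A → B)
    (h⁻¹-sound : ∀ a → P a ≡ true → Q (h⁻¹ a) ≡ true × h (h⁻¹ a) ≡ a)
    (h-sound : ∀ b → Q b ≡ true → P (h b) ≡ true × h⁻¹ (h b) ≡ b)
    where

    ∑-reindex : (f : A → Carrier) →
      ∑[ a ∈ as ] (if P a then f a else 0#) ≈ ∑[ b ∈ bs ] (if Q b then f (h b) else 0#)
    ∑-reindex f = begin
      ∑[ a ∈ as ] (if P a then f a else 0#)      ≈⟨ ∑-cong as (≈-sym ∘ column) ⟩
      ∑[ a ∈ as ] ∑[ b ∈ bs ] term a b           ≈⟨ ∑-comm as bs term ⟩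
      ∑[ b ∈ bs ] ∑[ a ∈ as ] term a b           ≈⟨ ∑-cong bs row ⟩
      ∑[ b ∈ bs ] (if Q b then f (h b) else 0#)  ∎
      where
      δ : A → A → Carrier
      δ a′ a = if ⌊ a′ ≟ a ⌋ then f a else 0#

      δ-diag : ∀ a → δ a a ≈ f a
      δ-diag a with a ≟ a
      ... | yes _  = ≈-refl
      ... | no a≢a = contradiction refl a≢a

      term : A → B → Carrier
      term a b = if Q b then δ (h b) a else 0#

      column : ∀ a → ∑[ b ∈ bs ] term a b ≈ (if P a then f a else 0#)
      column a with P a in Pa
      ... | true = ≈-trans (∑-single (term a) bs! (∈bs (h⁻¹ a)) off) on
        where
        on : term a (h⁻¹ a) ≈ f a
        on rewrite proj₁ (h⁻¹-sound a Pa) | proj₂ (h⁻¹-sound a Pa) = δ-diag a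
        off : ∀ b → b ≢ h⁻¹ a → term a b ≈ 0#
        off b b≢h⁻¹a with Q b in Qb
        ... | false = ≈-refl
        ... | true with h b ≟ a
        ...   | no _     = ≈-refl
        ...   | yes hb≡a = contradiction (trans (sym (proj₂ (h-sound b Qb))) (cong h⁻¹ hb≡a)) b≢h⁻¹a
      ... | false = ∑-zero (All.universal off bs)
        where
        off : ∀ b → term a b ≈ 0#
        off b with Q b in Qb
        ... | false = ≈-refl
        ... | true with h b ≟ a
        ...   | no _     = ≈-refl
        ...   | yes hb≡a =
          contradiction (trans (sym Pa) (subst (λ x → P x ≡ true) hb≡a (proj₁ (h-sound b Qb)))) λ ()

      row : ∀ b → ∑[ a ∈ as ] term a b ≈ (if Q b then f (h b) else 0#)
      row b with Q b
      ... | false = ∑-zero (All.universal (λ _ → ≈-refl) as)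
      ... | true  = ≈-trans (∑-single (δ (h b)) as! (∈as (h b)) off) (δ-diag (h b))
        where
        off : ∀ a → a ≢ h b → δ (h b) a ≈ 0#
        off a a≢hb with h b ≟ a
        ... | yes hb≡a = contradiction (sym hb≡a) a≢hb
        ... | no _     = ≈-refl

-- Transposing two values

Consecutive : ℕ → ℕ → Set
Consecutive i j = suc i ≡ j ⊎ suc j ≡ i

consecutive? : ∀ i j → Dec (Consecutive i j)
consecutive? i j = (suc i ℕ.≟ j) ⊎-dec (suc j ℕ.≟ i)

consecutive?-sym : ∀ i j → does (consecutive? i j) ≡ does (consecutive? j i)
consecutive?-sym i j = ∨-comm (does (suc i ℕ.≟ j)) (does (suc j ℕ.≟ i))

consecutive-<ᵇˡ : ∀ {i j z} → Consecutive i j → z ≢ i → z ≢ j → (i <ᵇ z) ≡ (j <ᵇ z)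
consecutive-<ᵇˡ (inj₁ refl) z≢i z≢j =
  <ᵇ-cong (mk⇔ (λ i<z → ℕₚ.≤∧≢⇒< i<z (z≢j ∘ sym)) (ℕₚ.<-trans (ℕₚ.n<1+n _)))
consecutive-<ᵇˡ (inj₂ refl) z≢i z≢j = sym (consecutive-<ᵇˡ (inj₁ refl) z≢j z≢i)

consecutive-<ᵇʳ : ∀ {i j z} → Consecutive i j → z ≢ i → z ≢ j → (z <ᵇ i) ≡ (z <ᵇ j)
consecutive-<ᵇʳ (inj₁ refl) z≢i z≢j =
  <ᵇ-cong (mk⇔ ℕₚ.m<n⇒m<1+n (λ z<1+i → ℕₚ.≤∧≢⇒< (ℕₚ.m<1+n⇒m≤n z<1+i) z≢i))
consecutive-<ᵇʳ (inj₂ refl) z≢i z≢j = sym (consecutive-<ᵇʳ (inj₁ refl) z≢j z≢i)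

module Transposition {M : ℕ} (u v : Fin M) where

  τ : Fin M → Fin M
  τ = Components.transpose u v

  τ-u : τ u ≡ v
  τ-u rewrite dec-true (u Finₚ.≟ u) refl = refl

  τ-v : τ v ≡ u
  τ-v with v Finₚ.≟ u
  ... | yes v≡u = v≡u
  ... | no _ rewrite dec-true (v Finₚ.≟ v) refl = refl

  τ-other : ∀ {x} → x ≢ u → x ≢ v → τ x ≡ x
  τ-other {x} x≢u x≢v rewrite dec-false (x Finₚ.≟ u) x≢u | dec-false (x Finₚ.≟ v) x≢v = refl

  data Class (x : Fin M) : Set where
    is-u  : x ≡ u → Class x
    is-v  : x ≡ v → Class x
    other : x ≢ u → x ≢ v → Class x

  classify : ∀ x → Class x
  classify x with x Finₚ.≟ u | x Finₚ.≟ v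
  ... | yes x≡u | _       = is-u x≡u
  ... | no _    | yes x≡v = is-v x≡v
  ... | no x≢u  | no x≢v  = other x≢u x≢v

  τ-involutive : ∀ x → τ (τ x) ≡ x
  τ-involutive x with classify x
  ... | is-u refl       = trans (cong τ τ-u) τ-v
  ... | is-v refl       = trans (cong τ τ-v) τ-u
  ... | other x≢u x≢v   = trans (cong τ (τ-other x≢u x≢v)) (τ-other x≢u x≢v)

  τ-injective : Injective _≡_ _≡_ τ
  τ-injective {x} {y} τx≡τy = trans (sym (τ-involutive x)) (trans (cong τ τx≡τy) (τ-involutive y))

  Pair : Fin M → Fin M → Set
  Pair x y = (x ≡ u × y ≡ v) ⊎ (x ≡ v × y ≡ u)

  Pair-sym : ∀ {x y} → Pair x y → Pair y x
  Pair-sym = Sum.swap ∘ Sum.map Product.swap Product.swap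

  τ-cancel : ∀ {x y} → τ x ≡ y → x ≡ τ y
  τ-cancel {x} refl = sym (τ-involutive x)

  Pair-τ : ∀ {x y} → Pair (τ x) (τ y) → Pair x y
  Pair-τ (inj₁ (τx≡u , τy≡v)) = inj₂ (trans (τ-cancel τx≡u) τ-u , trans (τ-cancel τy≡v) τ-v)
  Pair-τ (inj₂ (τx≡v , τy≡u)) = inj₁ (trans (τ-cancel τx≡v) τ-v , trans (τ-cancel τy≡u) τ-u)

  τ-preserves-<ᵇ : (f : Fin M → ℕ) → Injective _≡_ _≡_ f → Consecutive (f u) (f v) →
    ∀ x y → ¬ Pair x y → (f (τ x) <ᵇ f (τ y)) ≡ (f x <ᵇ f y)
  τ-preserves-<ᵇ f f-inj fu~fv x y ¬pair with x Finₚ.≟ y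
  ... | yes refl =
    trans (<ᵇ-false {f (τ x)} (ℕₚ.<-irrefl refl)) (sym (<ᵇ-false {f x} (ℕₚ.<-irrefl refl)))
  ... | no x≢y with classify x | classify y
  ...   | is-u refl | is-u refl       = contradiction refl x≢y
  ...   | is-v refl | is-v refl       = contradiction refl x≢y
  ...   | is-u refl | is-v refl       = contradiction (inj₁ (refl , refl)) ¬pair
  ...   | is-v refl | is-u refl       = contradiction (inj₂ (refl , refl)) ¬pair
  ...   | is-u refl | other y≢u y≢v   rewrite τ-u | τ-other y≢u y≢v =
          sym (consecutive-<ᵇˡ fu~fv (y≢u ∘ f-inj) (y≢v ∘ f-inj))
  ...   | is-v refl | other y≢u y≢v   rewrite τ-v | τ-other y≢u y≢v =
          consecutive-<ᵇˡ fu~fv (y≢u ∘ f-inj) (y≢v ∘ f-inj)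
  ...   | other x≢u x≢v | is-u refl   rewrite τ-u | τ-other x≢u x≢v =
          sym (consecutive-<ᵇʳ fu~fv (x≢u ∘ f-inj) (x≢v ∘ f-inj))
  ...   | other x≢u x≢v | is-v refl   rewrite τ-v | τ-other x≢u x≢v =
          consecutive-<ᵇʳ fu~fv (x≢u ∘ f-inj) (x≢v ∘ f-inj)
  ...   | other x≢u x≢v | other y≢u y≢v rewrite τ-other x≢u x≢v | τ-other y≢u y≢v = refl

  module _ {k} {ι : Fin k → Fin M} (misses-u : ∀ a → ι a ≢ u) where

    misses⇒¬Pair : ∀ a b → ¬ Pair (ι a) (ι b)
    misses⇒¬Pair a b (inj₁ (ιa≡u , _)) = misses-u a ιa≡u
    misses⇒¬Pair a b (inj₂ (_ , ιb≡u)) = misses-u b ιb≡u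

    τ∘-misses-v : ∀ a → τ (ι a) ≢ v
    τ∘-misses-v a τιa≡v = misses-u a (trans (τ-cancel τιa≡v) τ-v)

    τ∘-increasing : Consecutive (toℕ u) (toℕ v) → Increasing ι → Increasing (τ ∘ ι)
    τ∘-increasing u~v inc a b a<b =
      <ᵇ≡⇒< (τ-preserves-<ᵇ toℕ Finₚ.toℕ-injective u~v (ι a) (ι b) (misses⇒¬Pair a b)) (inc a b a<b)

  adjacent : ∀ {l} → Vec (Fin M) l → Bool
  adjacent w = does (consecutive? (posOf w u) (posOf w v))

  swapUnlessAdjacent : ∀ {l} → Vec (Fin M) l → Vec (Fin M) l
  swapUnlessAdjacent w = if adjacent w then w else Vec.map τ w

  swapUnlessAdjacent-adjacent : ∀ {l} (w : Vec (Fin M) l) → adjacent w ≡ true → swapUnlessAdjacent w ≡ w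
  swapUnlessAdjacent-adjacent w e = cong (λ b → if b then w else Vec.map τ w) e

  swapUnlessAdjacent-apart : ∀ {l} (w : Vec (Fin M) l) → adjacent w ≡ false →
    swapUnlessAdjacent w ≡ Vec.map τ w
  swapUnlessAdjacent-apart w e = cong (λ b → if b then w else Vec.map τ w) e

  posOf-map-τ : ∀ {l} (w : Vec (Fin M) l) x → posOf (Vec.map τ w) x ≡ posOf w (τ x)
  posOf-map-τ w x = subst (λ y → posOf (Vec.map τ w) y ≡ posOf w (τ x)) (τ-involutive x)
    (posOf-map τ-injective w (τ x))

  adjacent-map-τ : ∀ {l} (w : Vec (Fin M) l) → adjacent (Vec.map τ w) ≡ adjacent w
  adjacent-map-τ w rewrite posOf-map-τ w u | posOf-map-τ w v | τ-u | τ-v =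
    consecutive?-sym (posOf w v) (posOf w u)

  map-τ-involutive : ∀ {l} (w : Vec (Fin M) l) → Vec.map τ (Vec.map τ w) ≡ w
  map-τ-involutive w =
    trans (sym (Vecₚ.map-∘ τ τ w)) (trans (Vecₚ.map-cong τ-involutive w) (Vecₚ.map-id w))

  swapUnlessAdjacent-involutive : ∀ {l} (w : Vec (Fin M) l) → swapUnlessAdjacent (swapUnlessAdjacent w) ≡ w
  swapUnlessAdjacent-involutive w with adjacent w in e
  ... | true  = swapUnlessAdjacent-adjacent w e
  ... | false = trans (swapUnlessAdjacent-apart (Vec.map τ w) (trans (adjacent-map-τ w) e)) (map-τ-involutive w)

  distinct-map-τ : ∀ {l} (w : Vec (Fin M) l) → Distinct w → Distinct (Vec.map τ w)
  distinct-map-τ w w-inj {i} {j} e = w-inj (τ-injective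
    (trans (sym (Vecₚ.lookup-map i τ w)) (trans e (Vecₚ.lookup-map j τ w))))

  distinct-swapUnlessAdjacent : ∀ {l} (w : Vec (Fin M) l) → Distinct w → Distinct (swapUnlessAdjacent w)
  distinct-swapUnlessAdjacent w w-inj with adjacent w
  ... | true  = w-inj
  ... | false = distinct-map-τ w w-inj

  majFrom-map-τ : Consecutive (toℕ u) (toℕ v) → ∀ {l} (w : Vec (Fin M) l) →
    (∀ i j → toℕ j ≡ suc (toℕ i) → ¬ Pair (lookup w i) (lookup w j)) →
    ∀ s → majFrom s (Vec.map τ w) ≡ majFrom s w
  majFrom-map-τ u~v []          _     s = refl
  majFrom-map-τ u~v (x ∷ [])    _     s = refl
  majFrom-map-τ u~v (x ∷ y ∷ w) apart s = cong₂ ℕ._+_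
    (cong (λ b → if b then s else 0)
      (τ-preserves-<ᵇ toℕ Finₚ.toℕ-injective u~v y x (apart Fin.zero (Fin.suc Fin.zero) refl ∘ Pair-sym)))
    (majFrom-map-τ u~v (y ∷ w) (λ i j j≡1+i → apart (Fin.suc i) (Fin.suc j) (cong suc j≡1+i)) (suc s))

  nonadjacent⇒no-neighbouring-Pair : ∀ {l} (w : Vec (Fin M) l) → Distinct w → adjacent w ≡ false →
    ∀ i j → toℕ j ≡ suc (toℕ i) → ¬ Pair (lookup w i) (lookup w j)
  nonadjacent⇒no-neighbouring-Pair w w-inj e i j j≡1+i pair =
    contradiction (trans (sym (dec-true (consecutive? (posOf w u) (posOf w v)) (consecutive pair))) e) λ ()
    where
    posOf-at : ∀ {p x} → lookup w p ≡ x → posOf w x ≡ toℕ p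
    posOf-at {p} refl = posOf-lookup w w-inj p
    next : ∀ {x y} → lookup w i ≡ x → lookup w j ≡ y → suc (posOf w x) ≡ posOf w y
    next wᵢ≡x wⱼ≡y = trans (cong suc (posOf-at wᵢ≡x)) (trans (sym j≡1+i) (sym (posOf-at wⱼ≡y)))
    consecutive : Pair (lookup w i) (lookup w j) → Consecutive (posOf w u) (posOf w v)
    consecutive (inj₁ (wᵢ≡u , wⱼ≡v)) = inj₁ (next wᵢ≡u wⱼ≡v)
    consecutive (inj₂ (wᵢ≡v , wⱼ≡u)) = inj₂ (next wᵢ≡v wⱼ≡u)

  maj-swapUnlessAdjacent : Consecutive (toℕ u) (toℕ v) → ∀ {l} (w : Vec (Fin M) l) → Distinct w →
    maj (swapUnlessAdjacent w) ≡ maj w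
  maj-swapUnlessAdjacent u~v w w-inj with adjacent w in e
  ... | true  = refl
  ... | false = majFrom-map-τ u~v w (nonadjacent⇒no-neighbouring-Pair w w-inj e) 1

  occursAt-swapUnlessAdjacent : ∀ {k} (w : Vec (Fin M) M) → Distinct w → (ι : Fin k → Fin M) →
    (∀ a b → ¬ Pair (ι a) (ι b)) → (σ : Vec (Fin k) k) →
    occursAt (swapUnlessAdjacent w) ι σ ≡ occursAt w (τ ∘ ι) σ
  occursAt-swapUnlessAdjacent w w-inj ι avoids σ =
    occursAt-cong (swapUnlessAdjacent w) ι w (τ ∘ ι) σ before-agree
    where
    before-agree : ∀ a b → before (swapUnlessAdjacent w) ι a b ≡ before w (τ ∘ ι) a b
    before-agree a b with adjacent w in e
    ... | true  = sym (τ-preserves-<ᵇ (posOf w) (posOf-injective w w-inj)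
                    (does≡true⇒ (consecutive? (posOf w u) (posOf w v)) e) (ι a) (ι b) (avoids a b))
    ... | false = cong₂ _<ᵇ_ (posOf-map-τ w (ι a)) (posOf-map-τ w (ι b))

-- Inserting a maximal letter into a word (MacMahon)

listMajFrom : ℕ → List ℕ → ℕ
listMajFrom i []           = 0
listMajFrom i (x ∷ [])     = 0
listMajFrom i (x ∷ y ∷ xs) = (if y <ᵇ x then i else 0) ℕ.+ listMajFrom (suc i) (y ∷ xs)

listMaj : List ℕ → ℕ
listMaj = listMajFrom 1

insertGap : ℕ → ℕ → List ℕ → List ℕ
insertGap zero    b xs       = b ∷ xs
insertGap (suc g) b []       = b ∷ []
insertGap (suc g) b (x ∷ xs) = x ∷ insertGap g b xs

descentAt : ℕ → ℕ → List ℕ → ℕ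
descentAt i x []      = 0
descentAt i x (y ∷ _) = if y <ᵇ x then i else 0

listMajFrom-∷ : ∀ i x xs → listMajFrom i (x ∷ xs) ≡ descentAt i x xs ℕ.+ listMajFrom (suc i) xs
listMajFrom-∷ i x []      = refl
listMajFrom-∷ i x (_ ∷ _) = refl

listMajFrom-∷ʳ : ∀ i xs y x →
  listMajFrom i ((xs ∷ʳ y) ∷ʳ x)
    ≡ listMajFrom i (xs ∷ʳ y) ℕ.+ (if x <ᵇ y then i ℕ.+ List.length xs else 0)
listMajFrom-∷ʳ i [] y x with x <ᵇ y
... | true  = refl
... | false = refl
listMajFrom-∷ʳ i (z ∷ xs) y x = begin
    listMajFrom i (z ∷ ((xs ∷ʳ y) ∷ʳ x))
  ≡⟨ listMajFrom-∷ i z ((xs ∷ʳ y) ∷ʳ x) ⟩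
    descentAt i z ((xs ∷ʳ y) ∷ʳ x) ℕ.+ listMajFrom (suc i) ((xs ∷ʳ y) ∷ʳ x)
  ≡⟨ cong₂ ℕ._+_ (descentAt-∷ʳ xs) (listMajFrom-∷ʳ (suc i) xs y x) ⟩
    descentAt i z (xs ∷ʳ y) ℕ.+ (listMajFrom (suc i) (xs ∷ʳ y) ℕ.+ last-descent (suc i ℕ.+ List.length xs))
  ≡⟨ ℕₚ.+-assoc (descentAt i z (xs ∷ʳ y)) _ _ ⟨
    (descentAt i z (xs ∷ʳ y) ℕ.+ listMajFrom (suc i) (xs ∷ʳ y)) ℕ.+ last-descent (suc i ℕ.+ List.length xs)
  ≡⟨ cong₂ ℕ._+_ (listMajFrom-∷ i z (xs ∷ʳ y)) (cong last-descent (ℕₚ.+-suc i (List.length xs))) ⟨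
    listMajFrom i (z ∷ (xs ∷ʳ y)) ℕ.+ last-descent (i ℕ.+ suc (List.length xs)) ∎
  where
  open ≡-Reasoning
  last-descent : ℕ → ℕ
  last-descent p = if x <ᵇ y then p else 0
  descentAt-∷ʳ : ∀ ys → descentAt i z ((ys ∷ʳ y) ∷ʳ x) ≡ descentAt i z (ys ∷ʳ y)
  descentAt-∷ʳ []      = refl
  descentAt-∷ʳ (_ ∷ _) = refl

insertGap-∷ʳ : ∀ {g} b (xs : List ℕ) x → g ≤ List.length xs →
  insertGap g b (xs ∷ʳ x) ≡ insertGap g b xs ∷ʳ x
insertGap-∷ʳ {zero}  b xs       x _         = refl
insertGap-∷ʳ {suc g} b (y ∷ xs) x (s≤s g≤n) = cong (y ∷_) (insertGap-∷ʳ b xs x g≤n)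

insertGap-length : ∀ b (xs : List ℕ) → insertGap (List.length xs) b xs ≡ xs ∷ʳ b
insertGap-length b []       = refl
insertGap-length b (x ∷ xs) = cong (x ∷_) (insertGap-length b xs)

length-insertGap : ∀ {g} b (xs : List ℕ) → g ≤ List.length xs →
  List.length (insertGap g b xs) ≡ suc (List.length xs)
length-insertGap {zero}  b xs       _         = refl
length-insertGap {suc g} b (x ∷ xs) (s≤s g≤n) = cong suc (length-insertGap b xs g≤n)

listMaj-∷ʳ-max : ∀ {b} (xs : List ℕ) → All (ℕ._< b) xs → listMaj (xs ∷ʳ b) ≡ listMaj xs
listMaj-∷ʳ-max {b} xs xs<b with reverseView xs
... | []          = refl
... | ys ∶ _ ∶ʳ y = begin
    listMaj ((ys ∷ʳ y) ∷ʳ b)                                  ≡⟨ listMajFrom-∷ʳ 1 ys y b ⟩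
    listMaj (ys ∷ʳ y) ℕ.+ (if b <ᵇ y then suc (List.length ys) else 0)
      ≡⟨ cong (λ c → listMaj (ys ∷ʳ y) ℕ.+ (if c then suc (List.length ys) else 0)) b≮y ⟩
    listMaj (ys ∷ʳ y) ℕ.+ 0                                   ≡⟨ ℕₚ.+-identityʳ _ ⟩
    listMaj (ys ∷ʳ y)                                         ∎
  where
  open ≡-Reasoning
  b≮y : (b <ᵇ y) ≡ false
  b≮y = <ᵇ-false (ℕₚ.<⇒≯ (proj₂ (Allₚ.∷ʳ⁻ xs<b)))

length-∷ʳ : ∀ {A : Set} (xs : List A) x → List.length (xs ∷ʳ x) ≡ suc (List.length xs)
length-∷ʳ []       x = refl
length-∷ʳ (y ∷ xs) x = cong suc (length-∷ʳ xs x)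

listMaj-∷ʳ : ∀ ys y x →
  listMaj ((ys ∷ʳ y) ∷ʳ x) ≡ listMaj (ys ∷ʳ y) ℕ.+ (if x <ᵇ y then List.length (ys ∷ʳ y) else 0)
listMaj-∷ʳ ys y x = trans (listMajFrom-∷ʳ 1 ys y x)
  (cong (λ t → listMaj (ys ∷ʳ y) ℕ.+ (if x <ᵇ y then t else 0)) (sym (length-∷ʳ ys y)))

listMaj-insertGap-∷ʳ : ∀ {g b} ys y x → g ≤ List.length ys →
  listMaj (insertGap g b ((ys ∷ʳ y) ∷ʳ x))
    ≡ listMaj (insertGap g b (ys ∷ʳ y)) ℕ.+ (if x <ᵇ y then suc (List.length (ys ∷ʳ y)) else 0)
listMaj-insertGap-∷ʳ {g} {b} ys y x g≤ys = begin
  listMaj (insertGap g b ((ys ∷ʳ y) ∷ʳ x))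
    ≡⟨ cong listMaj (trans (insertGap-∷ʳ b (ys ∷ʳ y) x g≤ys∷ʳy)
                           (cong (_∷ʳ x) (insertGap-∷ʳ b ys y g≤ys))) ⟩
  listMaj ((insertGap g b ys ∷ʳ y) ∷ʳ x)
    ≡⟨ listMaj-∷ʳ (insertGap g b ys) y x ⟩
  listMaj (insertGap g b ys ∷ʳ y) ℕ.+ (if x <ᵇ y then List.length (insertGap g b ys ∷ʳ y) else 0)
    ≡⟨ cong₂ (λ w t → listMaj w ℕ.+ (if x <ᵇ y then t else 0))
             (sym (insertGap-∷ʳ b ys y g≤ys)) length-eq ⟩
  listMaj (insertGap g b (ys ∷ʳ y)) ℕ.+ (if x <ᵇ y then suc (List.length (ys ∷ʳ y)) else 0) ∎
  where
  open ≡-Reasoning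
  g≤ys∷ʳy : g ≤ List.length (ys ∷ʳ y)
  g≤ys∷ʳy = subst (g ≤_) (sym (length-∷ʳ ys y)) (ℕₚ.m≤n⇒m≤1+n g≤ys)
  length-eq : List.length (insertGap g b ys ∷ʳ y) ≡ suc (List.length (ys ∷ʳ y))
  length-eq = trans (length-∷ʳ (insertGap g b ys) y)
    (trans (cong suc (length-insertGap b ys g≤ys)) (cong suc (sym (length-∷ʳ ys y))))

listMaj-insertGap-last : ∀ {b} zs x → All (ℕ._< b) zs → x ℕ.< b →
  listMaj (insertGap (List.length zs) b (zs ∷ʳ x)) ≡ listMaj zs ℕ.+ suc (List.length zs)
listMaj-insertGap-last {b} zs x zs<b x<b = begin
  listMaj (insertGap (List.length zs) b (zs ∷ʳ x))
    ≡⟨ cong listMaj (trans (insertGap-∷ʳ b zs x ℕₚ.≤-refl) (cong (_∷ʳ x) (insertGap-length b zs))) ⟩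
  listMaj ((zs ∷ʳ b) ∷ʳ x)
    ≡⟨ listMajFrom-∷ʳ 1 zs b x ⟩
  listMaj (zs ∷ʳ b) ℕ.+ (if x <ᵇ b then suc (List.length zs) else 0)
    ≡⟨ cong₂ (λ m c → m ℕ.+ (if c then suc (List.length zs) else 0))
             (listMaj-∷ʳ-max zs zs<b) (<ᵇ-true x<b) ⟩
  listMaj zs ℕ.+ suc (List.length zs) ∎
  where open ≡-Reasoning

values : ∀ {M l} → Vec (Fin M) l → List ℕ
values w = map toℕ (Vec.toList w)

majFrom≡listMajFrom : ∀ {M l} i (w : Vec (Fin M) l) → majFrom i w ≡ listMajFrom i (values w)
majFrom≡listMajFrom i []          = refl
majFrom≡listMajFrom i (x ∷ [])    = refl
majFrom≡listMajFrom i (x ∷ y ∷ w) =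
  cong ((if toℕ y <ᵇ toℕ x then i else 0) ℕ.+_) (majFrom≡listMajFrom (suc i) (y ∷ w))

values-insertAt : ∀ {M l} (w : Vec (Fin M) l) g x →
  values (Vec.insertAt w g x) ≡ insertGap (toℕ g) (toℕ x) (values w)
values-insertAt w       Fin.zero    x = refl
values-insertAt (y ∷ w) (Fin.suc g) x = cong (toℕ y ∷_) (values-insertAt w g x)

values-map-inject₁ : ∀ {M l} (w : Vec (Fin M) l) → values (Vec.map inject₁ w) ≡ values w
values-map-inject₁ []      = refl
values-map-inject₁ (x ∷ w) = cong₂ _∷_ (Finₚ.toℕ-inject₁ x) (values-map-inject₁ w)

length-values : ∀ {M l} (w : Vec (Fin M) l) → List.length (values w) ≡ l
length-values []      = refl
length-values (x ∷ w) = cong suc (length-values w)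

values<M : ∀ {M l} (w : Vec (Fin M) l) → All (ℕ._< M) (values w)
values<M []      = []
values<M (x ∷ w) = Finₚ.toℕ<n x ∷ values<M w

skip : ℕ → ℕ → ℕ
skip g p = if p <ᵇ g then p else suc p

skip-suc : ∀ g p → skip (suc g) (suc p) ≡ suc (skip g p)
skip-suc g p with p <ᵇ g
... | true  = refl
... | false = refl

skip-<ᵇ : ∀ g a b → (skip g a <ᵇ skip g b) ≡ (a <ᵇ b)
skip-<ᵇ g a b with a ℕ.<? g | b ℕ.<? g
... | yes a<g | yes b<g rewrite <ᵇ-true a<g | <ᵇ-true b<g = refl
... | no a≮g  | no b≮g  rewrite <ᵇ-false a≮g | <ᵇ-false b≮g = refl
... | yes a<g | no b≮g  rewrite <ᵇ-true a<g | <ᵇ-false b≮g =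
  <ᵇ-cong (mk⇔ (λ _ → ℕₚ.<-≤-trans a<g (ℕₚ.≮⇒≥ b≮g))
               (λ _ → ℕₚ.<-≤-trans a<g (ℕₚ.m≤n⇒m≤1+n (ℕₚ.≮⇒≥ b≮g))))
... | no a≮g  | yes b<g rewrite <ᵇ-false a≮g | <ᵇ-true b<g =
  <ᵇ-cong (mk⇔ (λ 1+a<b → contradiction (ℕₚ.<-trans (ℕₚ.<-trans (ℕₚ.n<1+n a) 1+a<b) b<g) a≮g)
               (λ a<b → contradiction (ℕₚ.<-trans a<b b<g) a≮g))

posOf-insertAt : ∀ {M l} (w : Vec (Fin M) l) g {t x} → t ≢ x →
  posOf (Vec.insertAt w g t) x ≡ skip (toℕ g) (posOf w x)
posOf-insertAt w Fin.zero {t} {x} t≢x with t Finₚ.≟ x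
... | yes t≡x = contradiction t≡x t≢x
... | no _    = refl
posOf-insertAt (y ∷ w) (Fin.suc g) {x = x} t≢x with y Finₚ.≟ x
... | yes _ = refl
... | no _  = trans (cong suc (posOf-insertAt w g t≢x)) (sym (skip-suc (toℕ g) (posOf w x)))

-- Inverse of inject₁ away from the maximum, which is sent to the junk value fromℕ m.
clamp : ∀ {m} → Fin (suc (suc m)) → Fin (suc m)
clamp {m} x with suc m ℕ.≟ toℕ x
... | yes _    = fromℕ m
... | no x≢1+m = Fin.lower₁ x x≢1+m

clamp-inject₁ : ∀ {m} (x : Fin (suc m)) → clamp (inject₁ x) ≡ x
clamp-inject₁ {m} x with suc m ℕ.≟ toℕ (inject₁ x)
... | yes 1+m≡x = contradiction 1+m≡x (Finₚ.toℕ-inject₁-≢ x)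
... | no 1+m≢x  = Finₚ.lower₁-inject₁′ x 1+m≢x

inject₁-clamp : ∀ {m} (x : Fin (suc (suc m))) → x ≢ fromℕ (suc m) → inject₁ (clamp x) ≡ x
inject₁-clamp {m} x x≢max with suc m ℕ.≟ toℕ x
... | yes 1+m≡x =
  contradiction (Finₚ.toℕ-injective (trans (sym 1+m≡x) (sym (Finₚ.toℕ-fromℕ (suc m))))) x≢max
... | no 1+m≢x  = Finₚ.inject₁-lower₁ x 1+m≢x

lowerAll : ∀ {m} → Vec (Fin (suc m)) m → Vec (Fin m) m
lowerAll {zero}  [] = []
lowerAll {suc m} w  = Vec.map clamp w

lowerAll-map-inject₁ : ∀ {m} (v : Vec (Fin m) m) → lowerAll (Vec.map inject₁ v) ≡ v
lowerAll-map-inject₁ {zero}  [] = refl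
lowerAll-map-inject₁ {suc m} v  =
  trans (sym (Vecₚ.map-∘ clamp inject₁ v)) (trans (Vecₚ.map-cong clamp-inject₁ v) (Vecₚ.map-id v))

map-inject₁∘clamp : ∀ {m l} (w : Vec (Fin (suc (suc m))) l) → (∀ i → lookup w i ≢ fromℕ (suc m)) →
  Vec.map (inject₁ ∘ clamp) w ≡ w
map-inject₁∘clamp []      _     = refl
map-inject₁∘clamp (x ∷ w) w≢max =
  cong₂ _∷_ (inject₁-clamp x (w≢max Fin.zero)) (map-inject₁∘clamp w (w≢max ∘ Fin.suc))

map-inject₁-lowerAll : ∀ {m} (w : Vec (Fin (suc m)) m) → (∀ i → lookup w i ≢ fromℕ m) →
  Vec.map inject₁ (lowerAll w) ≡ w
map-inject₁-lowerAll {zero}  [] _     = refl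
map-inject₁-lowerAll {suc m} w  w≢max =
  trans (sym (Vecₚ.map-∘ inject₁ clamp w)) (map-inject₁∘clamp w w≢max)

module MaxInsertion (m : ℕ) where

  max : Fin (suc m)
  max = fromℕ m

  insertMax : ∀ {l} → Fin (suc l) → Vec (Fin m) l → Vec (Fin (suc m)) (suc l)
  insertMax g v = Vec.insertAt (Vec.map inject₁ v) g max

  lookup-insertMax-punchIn : ∀ {l} g (v : Vec (Fin m) l) j →
    lookup (insertMax g v) (Fin.punchIn g j) ≡ inject₁ (lookup v j)
  lookup-insertMax-punchIn g v j =
    trans (Vecₚ.insertAt-punchIn (Vec.map inject₁ v) g max j) (Vecₚ.lookup-map j inject₁ v)

  insertMax-≡max : ∀ {l} g (v : Vec (Fin m) l) {p} → lookup (insertMax g v) p ≡ max → p ≡ g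
  insertMax-≡max g v {p} vₚ≡max with g Finₚ.≟ p
  ... | yes g≡p = sym g≡p
  ... | no g≢p  = contradiction (trans (sym (lookup-insertMax-punchIn g v _))
                    (trans (cong (lookup (insertMax g v)) (Finₚ.punchIn-punchOut g≢p)) vₚ≡max))
                  (Finₚ.fromℕ≢inject₁ ∘ sym)

  distinct-insertMax : ∀ {l} g (v : Vec (Fin m) l) → Distinct v → Distinct (insertMax g v)
  distinct-insertMax g v v-inj {i} {j} wᵢ≡wⱼ with g Finₚ.≟ i | g Finₚ.≟ j
  ... | yes refl | _        = sym (insertMax-≡max g v (trans (sym wᵢ≡wⱼ) (Vecₚ.insertAt-lookup _ g max)))
  ... | no _     | yes refl = insertMax-≡max g v (trans wᵢ≡wⱼ (Vecₚ.insertAt-lookup _ g max))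
  ... | no g≢i   | no g≢j   = begin
      i                                 ≡⟨ Finₚ.punchIn-punchOut g≢i ⟨
      Fin.punchIn g (Fin.punchOut g≢i)  ≡⟨ cong (Fin.punchIn g) (v-inj (Finₚ.inject₁-injective inject₁-eq)) ⟩
      Fin.punchIn g (Fin.punchOut g≢j)  ≡⟨ Finₚ.punchIn-punchOut g≢j ⟩
      j                                 ∎
    where
    open ≡-Reasoning
    inject₁-eq : inject₁ (lookup v (Fin.punchOut g≢i)) ≡ inject₁ (lookup v (Fin.punchOut g≢j))
    inject₁-eq = trans (sym (lookup-insertMax-punchIn g v _)) (trans
      (cong (lookup (insertMax g v)) (Finₚ.punchIn-punchOut g≢i)) (trans wᵢ≡wⱼ
      (trans (cong (lookup (insertMax g v)) (sym (Finₚ.punchIn-punchOut g≢j))) (lookup-insertMax-punchIn g v _))))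

  distinct-insertMax⁻ : ∀ {l} g (v : Vec (Fin m) l) → Distinct (insertMax g v) → Distinct v
  distinct-insertMax⁻ g v w-inj {i} {j} vᵢ≡vⱼ = Finₚ.punchIn-injective g i j (w-inj
    (trans (lookup-insertMax-punchIn g v i) (trans (cong inject₁ vᵢ≡vⱼ) (sym (lookup-insertMax-punchIn g v j)))))

  positionOfMax : ∀ {l} → Vec (Fin (suc m)) (suc l) → Fin (suc l)
  positionOfMax w with VAny.any? (Finₚ._≟ max) w
  ... | yes found = VAny.index found
  ... | no _      = Fin.zero

  positionOfMax-unique : ∀ {l} (w : Vec (Fin (suc m)) (suc l)) p → lookup w p ≡ max →
    (∀ {p′} → lookup w p′ ≡ max → p′ ≡ p) → positionOfMax w ≡ p
  positionOfMax-unique w p wₚ≡max unique with VAny.any? (Finₚ._≟ max) w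
  ... | yes found = unique (VAnyₚ.lookup-index found)
  ... | no none   =
    contradiction (VAny.map (λ wₚ≡x → trans (sym wₚ≡x) wₚ≡max) (VMemₚ.∈-lookup p w)) none

  removeMax : Vec (Fin (suc m)) (suc m) → Fin (suc m) × Vec (Fin m) m
  removeMax w = positionOfMax w , lowerAll (Vec.removeAt w (positionOfMax w))

  removeMax-insertMax : ∀ g v → removeMax (insertMax g v) ≡ (g , v)
  removeMax-insertMax g v = cong₂ _,_ position≡g (begin
    lowerAll (Vec.removeAt (insertMax g v) (positionOfMax (insertMax g v)))
      ≡⟨ cong (lowerAll ∘ Vec.removeAt (insertMax g v)) position≡g ⟩
    lowerAll (Vec.removeAt (insertMax g v) g)
      ≡⟨ cong lowerAll (Vecₚ.removeAt-insertAt (Vec.map inject₁ v) g max) ⟩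
    lowerAll (Vec.map inject₁ v)
      ≡⟨ lowerAll-map-inject₁ v ⟩
    v ∎)
    where
    open ≡-Reasoning
    position≡g : positionOfMax (insertMax g v) ≡ g
    position≡g = positionOfMax-unique (insertMax g v) g
      (Vecₚ.insertAt-lookup (Vec.map inject₁ v) g max) (insertMax-≡max g v)

  insertMax-removeMax : ∀ w → Distinct w → uncurry insertMax (removeMax w) ≡ w
  insertMax-removeMax w w-inj = begin
    Vec.insertAt (Vec.map inject₁ (lowerAll rest)) g max
      ≡⟨ cong (λ r → Vec.insertAt r g max) (map-inject₁-lowerAll rest rest≢max) ⟩
    Vec.insertAt rest g max
      ≡⟨ cong (Vec.insertAt rest g) w[g]≡max ⟨
    Vec.insertAt rest g (lookup w g)
      ≡⟨ Vecₚ.insertAt-removeAt w g ⟩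
    w ∎
    where
    open ≡-Reasoning
    g : Fin (suc m)
    g = positionOfMax w
    rest : Vec (Fin (suc m)) m
    rest = Vec.removeAt w g
    w[g]≡max : lookup w g ≡ max
    w[g]≡max with injective⇒onto w-inj max
    ... | p , wₚ≡max = subst (λ p′ → lookup w p′ ≡ max) (sym g≡p) wₚ≡max
      where
      g≡p : g ≡ p
      g≡p = positionOfMax-unique w p wₚ≡max (λ wₚ′≡max → w-inj (trans wₚ′≡max (sym wₚ≡max)))
    lookup-rest : ∀ j → lookup rest j ≡ lookup w (Fin.punchIn g j)
    lookup-rest j = trans (cong (lookup rest) (sym (Finₚ.punchOut-punchIn g)))
                          (Vecₚ.removeAt-punchOut w (Finₚ.punchInᵢ≢i g j ∘ sym))
    rest≢max : ∀ j → lookup rest j ≢ max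
    rest≢max j restⱼ≡max =
      Finₚ.punchInᵢ≢i g j (w-inj (trans (sym (lookup-rest j)) (trans restⱼ≡max (sym w[g]≡max))))

  posOf-insertMax : ∀ {l} g (v : Vec (Fin m) l) x →
    posOf (insertMax g v) (inject₁ x) ≡ skip (toℕ g) (posOf v x)
  posOf-insertMax g v x = trans (posOf-insertAt (Vec.map inject₁ v) g Finₚ.fromℕ≢inject₁)
    (cong (skip (toℕ g)) (posOf-map Finₚ.inject₁-injective v x))

  occursAt-insertMax : ∀ {k} g (v : Vec (Fin m) m) (σ : Vec (Fin k) k) ι ι↓ →
    (∀ a → inject₁ (ι↓ a) ≡ ι a) → occursAt (insertMax g v) ι σ ≡ occursAt v ι↓ σ
  occursAt-insertMax g v σ ι ι↓ ι↓-lifts = occursAt-cong (insertMax g v) ι v ι↓ σ λ a b → begin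
    before (insertMax g v) ι a b
      ≡⟨ before-cong (insertMax g v) (sym ∘ ι↓-lifts) a b ⟩
    before (insertMax g v) (inject₁ ∘ ι↓) a b
      ≡⟨ cong₂ _<ᵇ_ (posOf-insertMax g v (ι↓ a)) (posOf-insertMax g v (ι↓ b)) ⟩
    skip (toℕ g) (inv v (ι↓ a)) <ᵇ skip (toℕ g) (inv v (ι↓ b)) ≡⟨ skip-<ᵇ (toℕ g) _ _ ⟩
    before v ι↓ a b                                    ∎
    where open ≡-Reasoning

  isPerm-insertMax : ∀ g (v : Vec (Fin m) m) → isPerm (insertMax g v) ≡ isPerm v
  isPerm-insertMax g v = ≡true⇔⇒≡ (mk⇔
    (λ e → from (isPerm≡true⇔ v) (distinct-insertMax⁻ g v (to (isPerm≡true⇔ (insertMax g v)) e)))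
    (λ e → from (isPerm≡true⇔ (insertMax g v)) (distinct-insertMax g v (to (isPerm≡true⇔ v) e))))

  isOccurrence-insertMax : ∀ {k} g (v : Vec (Fin m) m) (σ : Vec (Fin k) k) ι ι↓ →
    (∀ a → inject₁ (ι↓ a) ≡ ι a) → isOccurrence σ ι (insertMax g v) ≡ isOccurrence σ ι↓ v
  isOccurrence-insertMax g v σ ι ι↓ ι↓-lifts =
    cong₂ _∧_ (isPerm-insertMax g v) (occursAt-insertMax g v σ ι ι↓ ι↓-lifts)

  maj-insertMax : ∀ {l} g (v : Vec (Fin m) l) → maj (insertMax g v) ≡ listMaj (insertGap (toℕ g) m (values v))
  maj-insertMax g v = trans (majFrom≡listMajFrom 1 (insertMax g v)) (cong listMaj (trans
    (values-insertAt (Vec.map inject₁ v) g max)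
    (cong₂ (insertGap (toℕ g)) (Finₚ.toℕ-fromℕ m) (values-map-inject₁ v))))

module MaxInsertionSums {c ℓ : Level} (R : CommutativeSemiring c ℓ) (q : CommutativeSemiring.Carrier R) where
  open CommutativeSemiring R hiding (zero) renaming (refl to ≈-refl; sym to ≈-sym; trans to ≈-trans)
  open Sums R
  open import Relation.Binary.Reasoning.Setoid setoid
  open import Algebra.Solver.Ring.NaturalCoefficients.Default R

  q^ : ℕ → Carrier
  q^ = pow R q

  [_]q : ℕ → Carrier
  [_]q = qint R q

  q^-+ : ∀ a b → q^ (a ℕ.+ b) ≈ q^ a * q^ b
  q^-+ zero    b = ≈-sym (*-identityˡ _)
  q^-+ (suc a) b = ≈-trans (*-congˡ (q^-+ a b)) (≈-sym (*-assoc _ _ _))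

  [suc]q : ∀ L → q * [ L ]q + 1# ≈ [ suc L ]q
  [suc]q zero    = ≈-trans (+-congʳ (zeroʳ q)) (≈-trans (+-identityˡ 1#) (≈-sym (+-identityʳ 1#)))
  [suc]q (suc L) = begin
    q * (q^ L + [ L ]q) + 1#        ≈⟨ +-congʳ (distribˡ q _ _) ⟩
    (q * q^ L + q * [ L ]q) + 1#    ≈⟨ +-assoc _ _ _ ⟩
    q * q^ L + (q * [ L ]q + 1#)    ≈⟨ +-congˡ ([suc]q L) ⟩
    q * q^ L + [ suc L ]q           ∎

  -- Appending x to a word of length L and maj M that ends in y: each old gap gains a descent at L+1
  -- exactly when x < y, and the new gap before x contributes q^(M+L+1).
  last-gap-step : ∀ (x<y : Bool) L M →
    q^ (if x<y then suc L else 0) * (q * [ L ]q * q^ M) + q^ (M ℕ.+ suc L)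
      ≈ q * [ suc L ]q * q^ (M ℕ.+ (if x<y then L else 0))
  last-gap-step true L M = begin
      q^ (suc L) * (q * [ L ]q * q^ M) + q^ (M ℕ.+ suc L)
    ≈⟨ +-congˡ (q^-+ M (suc L)) ⟩
      (q * q^ L) * (q * [ L ]q * q^ M) + q^ M * (q * q^ L)
    ≈⟨ solve 4 (λ q [L] q^M q^L → (q :* q^L) :* (q :* [L] :* q^M) :+ q^M :* (q :* q^L)
                                 := (q :* q^L :* q^M) :* (q :* [L] :+ con 1)) ≈-refl q [ L ]q (q^ M) (q^ L) ⟩
      (q * q^ L * q^ M) * (q * [ L ]q + 1#)
    ≈⟨ *-congˡ ([suc]q L) ⟩
      (q * q^ L * q^ M) * [ suc L ]q
    ≈⟨ solve 4 (λ q [L+1] q^M q^L → (q :* q^L :* q^M) :* [L+1] := q :* [L+1] :* (q^M :* q^L))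
               ≈-refl q [ suc L ]q (q^ M) (q^ L) ⟩
      q * [ suc L ]q * (q^ M * q^ L)
    ≈⟨ *-congˡ (≈-sym (q^-+ M L)) ⟩
      q * [ suc L ]q * q^ (M ℕ.+ L) ∎
  last-gap-step false L M = begin
      1# * (q * [ L ]q * q^ M) + q^ (M ℕ.+ suc L)
    ≈⟨ +-congˡ (q^-+ M (suc L)) ⟩
      1# * (q * [ L ]q * q^ M) + q^ M * (q * q^ L)
    ≈⟨ solve 4 (λ q [L] q^M q^L → con 1 :* (q :* [L] :* q^M) :+ q^M :* (q :* q^L)
                                 := q :* (q^L :+ [L]) :* (q^M :* con 1)) ≈-refl q [ L ]q (q^ M) (q^ L) ⟩
      q * [ suc L ]q * (q^ M * 1#)
    ≈⟨ *-congˡ (≈-sym (q^-+ M 0)) ⟩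
      q * [ suc L ]q * q^ (M ℕ.+ 0) ∎

  GapsBeforeLast : ℕ → List ℕ → Set ℓ
  GapsBeforeLast b xs =
    ∑[ g ∈ List.upTo (List.length xs) ] q^ (listMaj (insertGap g b xs))
      ≈ q * [ List.length xs ]q * q^ (listMaj xs)

  gapsBeforeLast-∷ʳ : ∀ {b} ys y x → All (ℕ._< b) ((ys ∷ʳ y) ∷ʳ x) →
    GapsBeforeLast b (ys ∷ʳ y) → GapsBeforeLast b ((ys ∷ʳ y) ∷ʳ x)
  gapsBeforeLast-∷ʳ {b} ys y x xs<b ih rewrite length-∷ʳ (ys ∷ʳ y) x = begin
      ∑ (List.upTo (suc L)) f
    ≈⟨ ∑-upTo-suc L f ⟩
      ∑ (List.upTo L) f + f L
    ≈⟨ +-cong (∑-cong-All (Allₚ.applyUpTo⁺₁ id L interior)) last ⟩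
      ∑[ g ∈ List.upTo L ] (q^ D * f′ g) + q^ (M ℕ.+ suc L)
    ≈⟨ +-congʳ (*-distribˡ-∑ (q^ D) (List.upTo L) f′) ⟨
      q^ D * ∑ (List.upTo L) f′ + q^ (M ℕ.+ suc L)
    ≈⟨ +-congʳ (*-congˡ ih) ⟩
      q^ D * (q * [ L ]q * q^ M) + q^ (M ℕ.+ suc L)
    ≈⟨ last-gap-step (x <ᵇ y) L M ⟩
      q * [ suc L ]q * q^ (M ℕ.+ (if x <ᵇ y then L else 0))
    ≡⟨ cong (λ t → q * [ suc L ]q * q^ t) (listMaj-∷ʳ ys y x) ⟨
      q * [ suc L ]q * q^ (listMaj ((ys ∷ʳ y) ∷ʳ x))
    ∎
    where
    zs : List ℕ
    zs = ys ∷ʳ y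
    L M D : ℕ
    L = List.length zs
    M = listMaj zs
    D = if x <ᵇ y then suc L else 0
    f f′ : ℕ → Carrier
    f  g = q^ (listMaj (insertGap g b (zs ∷ʳ x)))
    f′ g = q^ (listMaj (insertGap g b zs))
    interior : ∀ {g} → g ℕ.< L → f g ≈ q^ D * f′ g
    interior {g} g<L = begin
      q^ (listMaj (insertGap g b (zs ∷ʳ x)))  ≡⟨ cong q^ (listMaj-insertGap-∷ʳ ys y x g≤ys) ⟩
      q^ (listMaj (insertGap g b zs) ℕ.+ D)   ≈⟨ q^-+ (listMaj (insertGap g b zs)) D ⟩
      f′ g * q^ D                             ≈⟨ *-comm _ _ ⟩
      q^ D * f′ g                             ∎
      where
      g≤ys : g ≤ List.length ys
      g≤ys = ℕₚ.≤-pred (subst (g ℕ.<_) (length-∷ʳ ys y) g<L)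
    last : f L ≈ q^ (M ℕ.+ suc L)
    last = reflexive (cong q^ (listMaj-insertGap-last zs x zs<b x<b))
      where
      zs<b : All (ℕ._< b) zs
      zs<b = proj₁ (Allₚ.∷ʳ⁻ xs<b)
      x<b : x ℕ.< b
      x<b = proj₂ (Allₚ.∷ʳ⁻ xs<b)

  gapsBeforeLast : ∀ {b} xs → All (ℕ._< b) xs → GapsBeforeLast b xs
  gapsBeforeLast {b} xs = go (reverseView xs)
    where
    go : ∀ {xs} → Reverse xs → All (ℕ._< b) xs → GapsBeforeLast b xs
    go []                   _          = solve 1 (λ q → con 0 := q :* con 0 :* con 1) ≈-refl q
    go (_ ∶ [] ∶ʳ x)        (x<b ∷ []) rewrite <ᵇ-true x<b =
      solve 1 (λ q → q :* con 1 :+ con 0 := q :* (con 1 :+ con 0) :* con 1) ≈-refl q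
    go (_ ∶ (ys ∶ rs ∶ʳ y) ∶ʳ x) xs<b =
      gapsBeforeLast-∷ʳ ys y x xs<b (go (ys ∶ rs ∶ʳ y) (proj₁ (Allₚ.∷ʳ⁻ xs<b)))

  allGaps : ∀ {b} xs → All (ℕ._< b) xs →
    ∑[ g ∈ List.upTo (suc (List.length xs)) ] q^ (listMaj (insertGap g b xs))
      ≈ [ suc (List.length xs) ]q * q^ (listMaj xs)
  allGaps {b} xs xs<b = begin
    ∑ (List.upTo (suc L)) f           ≈⟨ ∑-upTo-suc L f ⟩
    ∑ (List.upTo L) f + f L           ≈⟨ +-cong (gapsBeforeLast xs xs<b) (reflexive (cong q^ last-gap)) ⟩
    q * [ L ]q * q^ M + q^ M          ≈⟨ solve 3 (λ q [L] q^M → q :* [L] :* q^M :+ q^M := (q :* [L] :+ con 1) :* q^M)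
                                                 ≈-refl q [ L ]q (q^ M) ⟩
    (q * [ L ]q + 1#) * q^ M          ≈⟨ *-congʳ ([suc]q L) ⟩
    [ suc L ]q * q^ M                 ∎
    where
    L M : ℕ
    L = List.length xs
    M = listMaj xs
    f : ℕ → Carrier
    f g = q^ (listMaj (insertGap g b xs))
    last-gap : listMaj (insertGap L b xs) ≡ M
    last-gap = trans (cong listMaj (insertGap-length b xs)) (listMaj-∷ʳ-max xs xs<b)

  ∑-insertMax : ∀ {m l} (v : Vec (Fin m) l) →
    ∑[ g ∈ allFin (suc l) ] q^ (maj (MaxInsertion.insertMax m g v)) ≈ [ suc l ]q * q^ (maj v)
  ∑-insertMax {m} {l} v = begin
      ∑[ g ∈ allFin (suc l) ] q^ (maj (insertMax g v))
    ≈⟨ ∑-cong (allFin (suc l)) (λ g → reflexive (cong q^ (maj-insertMax g v))) ⟩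
      ∑[ g ∈ allFin (suc l) ] q^ (listMaj (insertGap (toℕ g) m (values v)))
    ≡⟨ ∑-allFin (suc l) (λ i → q^ (listMaj (insertGap i m (values v)))) ⟩
      ∑[ i ∈ List.upTo (suc l) ] q^ (listMaj (insertGap i m (values v)))
    ≈⟨ subst (λ L → ∑[ i ∈ List.upTo (suc L) ] q^ (listMaj (insertGap i m (values v)))
                      ≈ [ suc L ]q * q^ (listMaj (values v)))
             (length-values v) (allGaps (values v) (values<M v)) ⟩
      [ suc l ]q * q^ (listMaj (values v))
    ≡⟨ cong (λ t → [ suc l ]q * q^ t) (sym (majFrom≡listMajFrom 1 v)) ⟩
      [ suc l ]q * q^ (maj v) ∎
    where open MaxInsertion m

-- The occurrence sum

module OccurrenceSums {c ℓ : Level} (R : CommutativeSemiring c ℓ) (q : CommutativeSemiring.Carrier R) where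
  open CommutativeSemiring R hiding (zero) renaming (refl to ≈-refl; sym to ≈-sym; trans to ≈-trans)
  open Sums R
  open MaxInsertionSums R q using (q^; [_]q; ∑-insertMax)
  open import Relation.Binary.Reasoning.Setoid setoid

  occurrenceSum : ∀ n {k} → Vec (Fin k) k → (Fin k → Fin n) → Carrier
  occurrenceSum n σ ι = ∑[ w ∈ allVecs n n ] (if isOccurrence σ ι w then q^ (maj w) else 0#)

  majSum≈occurrenceSum : ∀ n {k} (σ : Vec (Fin k) k) (ι : Fin k → Fin n) →
    majSum R q (filterᵇ (λ π → occursAt π ι σ) (perms n)) ≈ occurrenceSum n σ ι
  majSum≈occurrenceSum n σ ι = begin
    ∑ (filterᵇ (λ π → occursAt π ι σ) (filterᵇ isPerm (allVecs n n))) (q^ ∘ maj)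
      ≈⟨ ∑-filterᵇ (λ π → occursAt π ι σ) (perms n) _ ⟩
    ∑ (filterᵇ isPerm (allVecs n n)) (λ w → if occursAt w ι σ then q^ (maj w) else 0#)
      ≈⟨ ∑-filterᵇ isPerm (allVecs n n) _ ⟩
    ∑[ w ∈ allVecs n n ] (if isPerm w then (if occursAt w ι σ then q^ (maj w) else 0#) else 0#)
      ≈⟨ ∑-cong (allVecs n n) (λ w → nested-if (isPerm w) (occursAt w ι σ)) ⟩
    occurrenceSum n σ ι ∎
    where
    nested-if : ∀ b b′ {x} → (if b then (if b′ then x else 0#) else 0#) ≈ (if b ∧ b′ then x else 0#)
    nested-if true  _ = ≈-refl
    nested-if false _ = ≈-refl

  occurrenceSum-full : ∀ {n} (σ : Vec (Fin n) n) → isPerm σ ≡ true →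
    (ι : Fin n → Fin n) → Increasing ι → occurrenceSum n σ ι ≈ q^ (maj σ)
  occurrenceSum-full {n} σ σ-perm ι inc =
    ≈-trans (∑-single _ (allVecs-unique n n) (∈-allVecs n n σ) off) on
    where
    ι≗id : ∀ a → ι a ≡ a
    ι≗id = increasing⇒≡id inc
    on : (if isOccurrence σ ι σ then q^ (maj σ) else 0#) ≈ q^ (maj σ)
    on rewrite σ-perm | from (occursAt≡true⇔ σ ι σ) (before-cong σ ι≗id) = ≈-refl
    off : ∀ w → w ≢ σ → (if isOccurrence σ ι w then q^ (maj w) else 0#) ≈ 0#
    off w w≢σ with isOccurrence σ ι w in e
    ... | false = ≈-refl
    ... | true  = contradiction (order-of-positions-determines-word w σ w-inj (to (isPerm≡true⇔ σ) σ-perm)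
                    (λ a b → trans (sym (before-cong w ι≗id a b)) (to (occursAt≡true⇔ w ι σ) w-occ a b))) w≢σ
      where
      w-inj : Distinct w
      w-inj = proj₁ (to (isOccurrence≡true⇔ σ ι w) e)
      w-occ : occursAt w ι σ ≡ true
      w-occ = proj₂ (to (isOccurrence≡true⇔ σ ι w) e)

  module _ {n : ℕ} (u v : Fin n) (u~v : Consecutive (toℕ u) (toℕ v)) where
    open Transposition u v

    occurrenceSum-transpose : ∀ {k} (σ : Vec (Fin k) k) (ι : Fin k → Fin n) →
      (∀ a b → ¬ Pair (ι a) (ι b)) → occurrenceSum n σ ι ≈ occurrenceSum n σ (τ ∘ ι)
    occurrenceSum-transpose σ ι avoids = ≈-trans
      (∑-reindex (Vecₚ.≡-dec Finₚ._≟_)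
        (allVecs-unique n n) (∈-allVecs n n) (allVecs-unique n n) (∈-allVecs n n)
        swapUnlessAdjacent swapUnlessAdjacent forth back (q^ ∘ maj))
      (∑-cong (allVecs n n) same-weight)
      where
      forth : ∀ w → isOccurrence σ ι w ≡ true →
        isOccurrence σ (τ ∘ ι) (swapUnlessAdjacent w) ≡ true × swapUnlessAdjacent (swapUnlessAdjacent w) ≡ w
      forth w e =
          from (isOccurrence≡true⇔ σ (τ ∘ ι) (swapUnlessAdjacent w)) (distinct-swapUnlessAdjacent w w-inj , occ)
        , swapUnlessAdjacent-involutive w
        where
        w-inj : Distinct w
        w-inj = proj₁ (to (isOccurrence≡true⇔ σ ι w) e)
        occ : occursAt (swapUnlessAdjacent w) (τ ∘ ι) σ ≡ true
        occ = trans (occursAt-swapUnlessAdjacent w w-inj (τ ∘ ι) (λ a b → avoids a b ∘ Pair-τ) σ)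
             (trans (occursAt-cong w (τ ∘ τ ∘ ι) w ι σ (before-cong w (τ-involutive ∘ ι)))
                    (proj₂ (to (isOccurrence≡true⇔ σ ι w) e)))
      back : ∀ w → isOccurrence σ (τ ∘ ι) w ≡ true →
        isOccurrence σ ι (swapUnlessAdjacent w) ≡ true × swapUnlessAdjacent (swapUnlessAdjacent w) ≡ w
      back w e =
          from (isOccurrence≡true⇔ σ ι (swapUnlessAdjacent w)) (distinct-swapUnlessAdjacent w w-inj , occ)
        , swapUnlessAdjacent-involutive w
        where
        w-inj : Distinct w
        w-inj = proj₁ (to (isOccurrence≡true⇔ σ (τ ∘ ι) w) e)
        occ : occursAt (swapUnlessAdjacent w) ι σ ≡ true
        occ = trans (occursAt-swapUnlessAdjacent w w-inj ι avoids σ)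
                    (proj₂ (to (isOccurrence≡true⇔ σ (τ ∘ ι) w) e))
      same-weight : ∀ w → (if isOccurrence σ (τ ∘ ι) w then q^ (maj (swapUnlessAdjacent w)) else 0#)
                        ≈ (if isOccurrence σ (τ ∘ ι) w then q^ (maj w) else 0#)
      same-weight w with isOccurrence σ (τ ∘ ι) w in e
      ... | false = ≈-refl
      ... | true rewrite maj-swapUnlessAdjacent u~v w (proj₁ (to (isOccurrence≡true⇔ σ (τ ∘ ι) w) e)) =
        ≈-refl

  occurrenceSum-insertMax : ∀ {m k} (σ : Vec (Fin k) k) (ι : Fin k → Fin (suc m)) (ι↓ : Fin k → Fin m) →
    (∀ a → inject₁ (ι↓ a) ≡ ι a) → occurrenceSum (suc m) σ ι ≈ [ suc m ]q * occurrenceSum m σ ι↓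
  occurrenceSum-insertMax {m} σ ι ι↓ ι↓-lifts = begin
      occurrenceSum (suc m) σ ι
    ≈⟨ ∑-reindex (Vecₚ.≡-dec Finₚ._≟_) (allVecs-unique (suc m) (suc m)) (∈-allVecs (suc m) (suc m))
         (Uniqueₚ.cartesianProduct⁺ (Uniqueₚ.allFin⁺ (suc m)) (allVecs-unique m m))
         (λ (g , v) → ∈-cartesianProduct⁺ (∈-allFin g) (∈-allVecs m m v))
         (uncurry insertMax) removeMax forth back (q^ ∘ maj) ⟩
      ∑[ (g , v) ∈ List.cartesianProduct (allFin (suc m)) (allVecs m m) ] weight g v
    ≈⟨ ∑-cartesianProductWith _,_ (allFin (suc m)) (allVecs m m) _ ⟩
      ∑[ g ∈ allFin (suc m) ] ∑[ v ∈ allVecs m m ] weight g v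
    ≈⟨ ∑-comm (allFin (suc m)) (allVecs m m) weight ⟩
      ∑[ v ∈ allVecs m m ] ∑[ g ∈ allFin (suc m) ] weight g v
    ≈⟨ ∑-cong (allVecs m m) (λ v → gaps v (isOccurrence σ ι↓ v)) ⟩
      ∑[ v ∈ allVecs m m ] ([ suc m ]q * (if isOccurrence σ ι↓ v then q^ (maj v) else 0#))
    ≈⟨ *-distribˡ-∑ [ suc m ]q (allVecs m m) _ ⟨
      [ suc m ]q * occurrenceSum m σ ι↓ ∎
    where
    open MaxInsertion m
    weight : Fin (suc m) → Vec (Fin m) m → Carrier
    weight g v = if isOccurrence σ ι↓ v then q^ (maj (insertMax g v)) else 0#
    gaps : ∀ v c → ∑[ g ∈ allFin (suc m) ] (if c then q^ (maj (insertMax g v)) else 0#)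
                   ≈ [ suc m ]q * (if c then q^ (maj v) else 0#)
    gaps v true  = ∑-insertMax v
    gaps v false = ≈-trans (∑-zero (All.universal (λ _ → ≈-refl) (allFin (suc m)))) (≈-sym (zeroʳ _))
    forth : ∀ w → isOccurrence σ ι w ≡ true →
      isOccurrence σ ι↓ (proj₂ (removeMax w)) ≡ true × uncurry insertMax (removeMax w) ≡ w
    forth w e = trans (sym (isOccurrence-insertMax g v σ ι ι↓ ι↓-lifts)) (trans (cong (isOccurrence σ ι) w≡) e)
              , w≡
      where
      g : Fin (suc m)
      g = proj₁ (removeMax w)
      v : Vec (Fin m) m
      v = proj₂ (removeMax w)
      w≡ : insertMax g v ≡ w
      w≡ = insertMax-removeMax w (proj₁ (to (isOccurrence≡true⇔ σ ι w) e))
    back : ∀ gv → isOccurrence σ ι↓ (proj₂ gv) ≡ true →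
      isOccurrence σ ι (uncurry insertMax gv) ≡ true × removeMax (uncurry insertMax gv) ≡ gv
    back (g , v) e = trans (isOccurrence-insertMax g v σ ι ι↓ ι↓-lifts) e , removeMax-insertMax g v

module _ {c ℓ : Level} (R : CommutativeSemiring c ℓ) (q : CommutativeSemiring.Carrier R)
  {k : ℕ} (σ : Vec (Fin k) k) (σ-perm : isPerm σ ≡ true) where
  open CommutativeSemiring R hiding (zero) renaming (refl to ≈-refl; sym to ≈-sym; trans to ≈-trans)
  open import Relation.Binary.Reasoning.Setoid setoid
  open import Algebra.Properties.CommutativeSemigroup *-commutativeSemigroup using (x∙yz≈y∙xz)
  open OccurrenceSums R q
  open MaxInsertionSums R q using (q^; [_]q)

  ProbabilityFormula : ∀ n → (Fin k → Fin n) → Set ℓ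
  ProbabilityFormula n ι = occurrenceSum n σ ι * qfact R q k ≈ q^ (maj σ) * qfact R q n

  probabilityFormula-max-missing : ∀ {m} → (∀ ι′ → Increasing ι′ → ProbabilityFormula m ι′) →
    ∀ ι → Increasing ι → (∀ a → ι a ≢ fromℕ m) → ProbabilityFormula (suc m) ι
  probabilityFormula-max-missing {m} IH ι inc misses-max = begin
    occurrenceSum (suc m) σ ι * qfact R q k            ≈⟨ *-congʳ (occurrenceSum-insertMax σ ι ι↓ ι↓-lifts) ⟩
    ([ suc m ]q * occurrenceSum m σ ι↓) * qfact R q k  ≈⟨ *-assoc _ _ _ ⟩
    [ suc m ]q * (occurrenceSum m σ ι↓ * qfact R q k)  ≈⟨ *-congˡ (IH ι↓ ι↓-inc) ⟩
    [ suc m ]q * (q^ (maj σ) * qfact R q m)            ≈⟨ x∙yz≈y∙xz _ _ _ ⟩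
    q^ (maj σ) * qfact R q (suc m)                     ∎
    where
    m≢ι : ∀ a → m ≢ toℕ (ι a)
    m≢ι a m≡ιa = misses-max a (Finₚ.toℕ-injective (trans (sym m≡ιa) (sym (Finₚ.toℕ-fromℕ m))))
    ι↓ : Fin k → Fin m
    ι↓ a = Fin.lower₁ (ι a) (m≢ι a)
    ι↓-lifts : ∀ a → inject₁ (ι↓ a) ≡ ι a
    ι↓-lifts a = Finₚ.inject₁-lower₁ (ι a) (m≢ι a)
    ι↓-inc : Increasing ι↓
    ι↓-inc a b a<b = subst₂ ℕ._<_
      (sym (Finₚ.toℕ-lower₁ (ι a) (m≢ι a))) (sym (Finₚ.toℕ-lower₁ (ι b) (m≢ι b))) (inc a b a<b)

  probabilityFormula-missing : ∀ {m} → (∀ ι′ → Increasing ι′ → ProbabilityFormula m ι′) →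
    ∀ y ι → Increasing ι → (∀ a → ι a ≢ y) → ProbabilityFormula (suc m) ι
  probabilityFormula-missing {m} IH = >-weakInduction P (probabilityFormula-max-missing IH) step
    where
    P : Fin (suc m) → Set ℓ
    P y = ∀ ι → Increasing ι → (∀ a → ι a ≢ y) → ProbabilityFormula (suc m) ι
    step : ∀ j → P (Fin.suc j) → P (inject₁ j)
    step j P[1+j] ι inc misses-j = ≈-trans
      (*-congʳ (occurrenceSum-transpose (inject₁ j) (Fin.suc j) j~1+j σ ι (misses⇒¬Pair misses-j)))
      (P[1+j] (τ ∘ ι) (τ∘-increasing misses-j j~1+j inc) (τ∘-misses-v misses-j))
      where
      open Transposition (inject₁ j) (Fin.suc j)
      j~1+j : Consecutive (toℕ (inject₁ j)) (suc (toℕ j))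
      j~1+j = inj₁ (cong suc (Finₚ.toℕ-inject₁ j))

  probabilityFormula : ∀ n (ι : Fin k → Fin n) → Increasing ι → k ≤ n → ProbabilityFormula n ι
  probabilityFormula-< : ∀ n (ι : Fin k → Fin n) → Increasing ι → k ℕ.< n → ProbabilityFormula n ι

  probabilityFormula n ι inc k≤n with k ℕ.≟ n
  ... | yes refl = *-congʳ (occurrenceSum-full σ σ-perm ι inc)
  ... | no k≢n   = probabilityFormula-< n ι inc (ℕₚ.≤∧≢⇒< k≤n k≢n)

  probabilityFormula-< (suc m) ι inc k<1+m with <⇒misses-value k<1+m ι
  ... | y , misses-y = probabilityFormula-missing IH y ι inc misses-y
    where
    IH : ∀ ι′ → Increasing ι′ → ProbabilityFormula m ι′
    IH ι′ inc′ = probabilityFormula m ι′ inc′ (ℕₚ.≤-pred k<1+m)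

proposition5p1 : {c ℓ : Level} (R : CommutativeSemiring c ℓ)
    (q : CommutativeSemiring.Carrier R) (n k : ℕ) → k ≤ n →
    (σ : Vec (Fin k) k) → isPerm σ ≡ true →
    (ι : Fin k → Fin n) → (∀ a b → a < b → ι a < ι b) →
    CommutativeSemiring._≈_ R
      (CommutativeSemiring._*_ R
        (majSum R q (filterᵇ (λ π → occursAt π ι σ) (perms n)))
        (qfact R q k))
      (CommutativeSemiring._*_ R (pow R q (maj σ)) (qfact R q n))
proposition5p1 R q n k k≤n σ σ-perm ι inc = CommutativeSemiring.trans R
  (CommutativeSemiring.*-congʳ R (OccurrenceSums.majSum≈occurrenceSum R q n σ ι))
  (probabilityFormula R q σ σ-perm n ι inc k≤n)
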